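{- For every $n\ge 1$, the Markov chain $X^0=X^0_{111}$ on $\Omega^0_n$ has the uniform distribution on $\Omega^0_n$ as its stationary distribution.
   Context: A complete configuration of length $n$ is a pair of rows (top and bottom) of $n$ cells each, each cell containing a black ($\bullet$) or a white ($\circ$) particle, such that (i) the two rows together contain $n$ black and $n$ white particles, and (ii) for every $j\in\{0,\dots,n\}$ the first $j$ columns contain at least as many black as white particles. $\Omega^0_n$ is the set of these. Columns are numbered $1,\dots,n$; wall $i\in\{0,\dots,n\}$ lies between columns $i$ and $i+1$ (wall $0$ = left border, wall $n$ = right border); $t_c,b_c$ are the top and bottom particles of column $c$. The map $T:\Omega^0_n\times\{0,\dots,n\}\to\Omega^0_n$ is defined by cases (unmentioned particles keep their relative order in their row): (a') $1\le i\le n-1$, $t_i=\bullet$, $t_{i+1}=\circ$, $b_{i+1}=\bullet$: with $j_1$ the smallest $j\in\{0,\dots,i-1\}$ such that $t_{j+1},\dots,t_{i-1}$ are white, remove column $i+1$ and reinsert it as column $j_1+1$. (a'') $1\le i\le n-1$, $t_i=\bullet$, $t_{i+1}=\circ$, $b_{i+1}=\circ$: with $j_2$ the largest $j\in\{i+1,\dots,n\}$ such that $t_{i+2},\dots,t_j$ are black, delete $t_i$ and insert a black particle as top cell $j_2$; delete $b_{i+1}$ and insert a white particle as bottom cell $j_2+1$ if $j_2<n$, bottom cell $n$ if $j_2=n$. (b) $i=0$, $t_1=\circ$: with $j_2$ the largest $j\in\{1,\dots,n\}$ such that $t_2,\dots,t_j$ are black, delete column $1$, insert a black particle as top cell $j_2$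 and a white particle as bottom cell $j_2+1$ if $j_2<n$, bottom cell $n$ if $j_2=n$. (c) $i=n$, $t_n=\bullet$: with $j_1$ the smallest $j\in\{0,\dots,n-1\}$ such that $t_{j+1},\dots,t_{n-1}$ are white, delete column $n$ and insert a column ($\circ$ on top, $\bullet$ below) as column $j_1+1$. (d) otherwise $T(\omega,i)=\omega$. For $\alpha,\beta,\gamma\in\,]0,1]$ the chain $X^0_{\alpha\beta\gamma}$ on $\Omega^0_n$ evolves as follows: at each time step a wall $i$ is chosen uniformly at random in $\{0,\dots,n\}$, and the next state is $T(X^0_{\alpha\beta\gamma}(t),i)$ with probability $\lambda(i)$ and $X^0_{\alpha\beta\gamma}(t)$ otherwise, where $\lambda(i)=\alpha$ for $1\le i\le n-1$, $\lambda(0)=\beta$, $\lambda(n)=\gamma$. $X^0=X^0_{111}$. -}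

module Defs where

open import Data.Bool using (Bool; true; false; if_then_else_; _∧_; not)
open import Data.Nat using (ℕ; zero; suc; _+_; _∸_; _≤ᵇ_; _<ᵇ_; _≡ᵇ_)
open import Data.List using (List; []; _∷_; map; upTo; length; _++_; foldr; concatMap; reverse)
open import Data.Product using (_×_; _,_; proj₁; proj₂)
open import Data.Rational using (ℚ; 0ℚ; 1ℚ; _/_) renaming (_+_ to _+ℚ_; _*_ to _*ℚ_; _-_ to _-ℚ_)
import Data.Integer as ℤ
open import Data.List.Membership.Propositional using (_∈_)
open import Relation.Binary.PropositionalEquality using (_≡_)

-- Particles: true = black (•), false = white (∘).
Particle : Set
Particle = Bool

black white : Particle
black = true
white = false

-- A configuration: (top row, bottom row), each a list of particles (cells 1..n).
Config : Set
Config = List Particle × List Particle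

-- particle in cell c (1-indexed); out of range gives white (never used in range)
cell : List Particle → ℕ → Particle
cell []       _             = white
cell (x ∷ xs) zero          = white
cell (x ∷ xs) (suc zero)    = x
cell (x ∷ xs) (suc (suc c)) = cell xs (suc c)

removeAt : ℕ → List Particle → List Particle
removeAt _             []       = []
removeAt zero          xs       = xs
removeAt (suc zero)    (x ∷ xs) = xs
removeAt (suc (suc p)) (x ∷ xs) = x ∷ removeAt (suc p) xs

insertAt : ℕ → Particle → List Particle → List Particle
insertAt zero          y xs       = y ∷ xs
insertAt (suc zero)    y xs       = y ∷ xs
insertAt (suc (suc p)) y []       = y ∷ []
insertAt (suc (suc p)) y (x ∷ xs) = x ∷ insertAt (suc p) y xs

-- the integer range a, a+1, ..., b (empty if b < a)
range : ℕ → ℕ → List ℕ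
range a b = map (a +_) (upTo (suc b ∸ a))

allB : (ℕ → Bool) → List ℕ → Bool
allB p = foldr (λ c r → p c ∧ r) true

allOf : Particle → List Particle → ℕ → ℕ → Bool
allOf x r a b = allB (λ c → eqP (cell r c)) (range a b)
  where
  eqP : Particle → Bool
  eqP true  = x
  eqP false = not x

firstSat : (ℕ → Bool) → List ℕ → ℕ → ℕ
firstSat p []       d = d
firstSat p (j ∷ js) d = if p j then j else firstSat p js d

smallest : ℕ → ℕ → (ℕ → Bool) → ℕ
smallest lo hi p = firstSat p (range lo hi) hi

largest : ℕ → ℕ → (ℕ → Bool) → ℕ
largest lo hi p = firstSat p (reverse (range lo hi)) lo

count : Particle → List Particle → ℕ
count x []       = 0
count x (y ∷ ys) = (if eqB x y then 1 else 0) + count x ys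
  where
  eqB : Bool → Bool → Bool
  eqB true true   = true
  eqB false false = true
  eqB _ _         = false

take : ℕ → List Particle → List Particle
take zero    _        = []
take (suc k) []       = []
take (suc k) (x ∷ xs) = x ∷ take k xs

isComplete : ℕ → Config → Bool
isComplete n (t , b) =
  (length t ≡ᵇ n) ∧ (length b ≡ᵇ n)
  ∧ (count black (t ++ b) ≡ᵇ n) ∧ (count white (t ++ b) ≡ᵇ n)
  ∧ allB (λ j → count white (take j t ++ take j b) ≤ᵇ count black (take j t ++ take j b))
         (range 0 n)

rows : ℕ → List (List Particle)
rows zero    = [] ∷ []
rows (suc n) = concatMap (λ r → (true ∷ r) ∷ (false ∷ r) ∷ []) (rows n)

filterB : {A : Set} → (A → Bool) → List A → List A
filterB p []       = []
filterB p (x ∷ xs) = if p x then x ∷ filterB p xs else filterB p xs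

Ω⁰ : ℕ → List Config
Ω⁰ n = filterB (isComplete n)
         (concatMap (λ t → map (λ b → (t , b)) (rows n)) (rows n))

T : ℕ → Config → ℕ → Config
T n ω@(t , b) i =
  if i ≡ᵇ 0 then caseB
  else if i ≡ᵇ n then caseC
  else if i <ᵇ n then caseA
  else ω
  where
  caseB : Config
  caseB =
    if cell t 1 then ω
    else
      let j₂ = largest 1 n (λ j → allOf black t 2 j)
      in  insertAt j₂ black (removeAt 1 t)
        , insertAt (if j₂ <ᵇ n then suc j₂ else n) white (removeAt 1 b)
  caseC : Config
  caseC =
    if cell t n then
      (let j₁ = smallest 0 (n ∸ 1) (λ j → allOf white t (suc j) (n ∸ 1))
       in  insertAt (suc j₁) white (removeAt n t)
         , insertAt (suc j₁) black (removeAt n b))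
    else ω
  caseA : Config
  caseA =
    if cell t i ∧ not (cell t (suc i)) then
      (if cell b (suc i) then
         (let j₁ = smallest 0 (i ∸ 1) (λ j → allOf white t (suc j) (i ∸ 1))
          in  insertAt (suc j₁) (cell t (suc i)) (removeAt (suc i) t)
            , insertAt (suc j₁) (cell b (suc i)) (removeAt (suc i) b))
       else
         (let j₂ = largest (suc i) n (λ j → allOf black t (suc (suc i)) j)
          in  insertAt j₂ black (removeAt i t)
            , insertAt (if j₂ <ᵇ n then suc j₂ else n) white (removeAt (suc i) b)))
    else ω

eqRow : List Particle → List Particle → Bool
eqRow []          []          = true
eqRow (true ∷ x)  (true ∷ y)  = eqRow x y
eqRow (false ∷ x) (false ∷ y) = eqRow x y
eqRow _           _           = false

eqConfig : Config → Config → Bool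
eqConfig (t , b) (t' , b') = eqRow t t' ∧ eqRow b b'

ind : Bool → ℚ
ind true  = 1ℚ
ind false = 0ℚ

sumℚ : {A : Set} → (A → ℚ) → List A → ℚ
sumℚ f = foldr (λ x r → f x +ℚ r) 0ℚ

rate : ℕ → ℚ → ℚ → ℚ → ℕ → ℚ
rate n α β γ i = if i ≡ᵇ 0 then β else if i ≡ᵇ n then γ else α

P : ℕ → ℚ → ℚ → ℚ → Config → Config → ℚ
P n α β γ ω ω' =
  sumℚ (λ i → (ℤ.+ 1 / suc n) *ℚ
          (rate n α β γ i *ℚ ind (eqConfig (T n ω i) ω')
           +ℚ (1ℚ -ℚ rate n α β γ i) *ℚ ind (eqConfig ω ω')))
       (range 0 n)

uniformWeight : ℕ → ℚ
uniformWeight zero    = 0ℚ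
uniformWeight (suc k) = ℤ.+ 1 / suc k

uniform : ℕ → Config → ℚ
uniform n ω = uniformWeight (length (Ω⁰ n))

IsStationary : ℕ → ℚ → ℚ → ℚ → (Config → ℚ) → Set
IsStationary n α β γ π =
  (ω' : Config) → ω' ∈ Ω⁰ n →
    sumℚ (λ ω → π ω *ℚ P n α β γ ω ω') (Ω⁰ n) ≡ π ω'

{-# OPTIONS --safe #-}
-- For α = β = γ = 1 the transition probability P(ω , ω′) is 1/(n+1) times the number of walls i
-- with T(ω , i) = ω′, so the uniform distribution is stationary as soon as every ω′ has
-- exactly n + 1 incoming moves (ω , i), i.e. the chain is doubly stochastic. As there are
-- |Ω⁰ₙ|·(n+1) moves, each landing in one configuration, it suffices to show that every in-degree
-- is at least n + 1. To that end every move into ω′ gets a label in {0,…,n}, and every label k is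
-- realised: if wall k of ω′ does not separate a • from a following ∘ in the top row, (ω′ , k) is a
-- loop; otherwise column k+1 together with the maximal run of ∘ after it (resp. of • before it)
-- determines which case of T to invert. Completeness of the constructed preimage is checked on the
-- description of Ω⁰ₙ by lattice paths.

module Submission where

open import Defs
open import Data.Bool using (Bool; true; false; if_then_else_; _∧_; not)
open import Data.Bool.Properties using (∧-zeroʳ; T-≡; not-¬)
open import Data.Nat using (ℕ; zero; suc; _+_; _*_; _∸_; _≤_; _<_; _≥_; z≤n; s≤s; _≡ᵇ_; _<ᵇ_; _≤ᵇ_; ⌊_/2⌋)
open import Data.Nat.Tactic.RingSolver using (solve-∀)
open import Data.Nat.Properties
open import Algebra.Properties.CommutativeSemigroup +-commutativeSemigroup using (interchange)
open import Data.Nat.Coprimality using (1-coprimeTo) renaming (sym to coprime-sym)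
import Data.Integer as ℤ
import Data.Integer.Properties as ℤ
open import Data.Rational using (ℚ; mkℚ; 1ℚ; _/_) renaming (_+_ to _+ℚ_; _*_ to _*ℚ_; _-_ to _-ℚ_)
import Data.Rational.Properties as ℚ
open import Data.List using (List; []; _∷_; _++_; _∷ʳ_; length; replicate; reverse; map; foldr; concatMap; cartesianProduct; applyUpTo; initLast; _∷ʳ′_)
open import Data.List.Properties using (length-++; length-replicate; length-map; ++-assoc; ++-identityʳ; reverse-++; unfold-reverse; map-applyUpTo; ∷ʳ-++)
open import Data.List.Membership.Propositional.Properties using (∈-map⁺; ∈-concat⁺′; ∈-cartesianProduct⁺)
open import Data.List.Membership.Propositional using (_∈_)
open import Data.List.Relation.Unary.Any using (here; there)
import Data.List.Relation.Unary.Any.Properties as Any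
open import Data.List.Relation.Unary.All using (All; []; _∷_)
import Data.List.Relation.Unary.All as All
open import Data.Product using (_×_; _,_; proj₁; proj₂; Σ)
open import Data.Sum using (inj₁; inj₂)
open import Data.Empty using (⊥-elim)
open import Function using (id; _∘_)
open import Function.Bundles using (Equivalence)
open import Relation.Nullary using (¬_; contradiction; yes; no)
open import Relation.Binary.PropositionalEquality

∧-true⁻ : ∀ {x y} → x ∧ y ≡ true → x ≡ true × y ≡ true
∧-true⁻ {true} p = refl , p

≡ᵇ-true⁻ : ∀ {m n} → (m ≡ᵇ n) ≡ true → m ≡ n
≡ᵇ-true⁻ {m} {n} p = ≡ᵇ⇒≡ m n (Equivalence.from T-≡ p)

≡ᵇ-true⁺ : ∀ {m n} → m ≡ n → (m ≡ᵇ n) ≡ true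
≡ᵇ-true⁺ {m} {n} p = Equivalence.to T-≡ (≡⇒≡ᵇ m n p)

≡ᵇ-false⁺ : ∀ {m n} → m ≢ n → (m ≡ᵇ n) ≡ false
≡ᵇ-false⁺ {m} {n} m≢n with m ≡ᵇ n in eq
... | true  = contradiction (≡ᵇ-true⁻ eq) m≢n
... | false = refl

<ᵇ-true⁺ : ∀ {m n} → m < n → (m <ᵇ n) ≡ true
<ᵇ-true⁺ m<n = Equivalence.to T-≡ (<⇒<ᵇ m<n)

<ᵇ-irrefl : ∀ n → (n <ᵇ n) ≡ false
<ᵇ-irrefl zero    = refl
<ᵇ-irrefl (suc n) = <ᵇ-irrefl n

interval : ℕ → ℕ → List ℕ
interval lo zero    = []
interval lo (suc l) = lo ∷ interval (suc lo) l

applyUpTo≗interval : ∀ (f : ℕ → ℕ) a l → (∀ k → f k ≡ a + k) → applyUpTo f l ≡ interval a l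
applyUpTo≗interval f a zero    f≗ = refl
applyUpTo≗interval f a (suc l) f≗ =
  cong₂ _∷_ (trans (f≗ 0) (+-identityʳ a))
            (applyUpTo≗interval (f ∘ suc) (suc a) l (λ k → trans (f≗ (suc k)) (+-suc a k)))

range≡interval : ∀ a b → range a b ≡ interval a (suc b ∸ a)
range≡interval a b =
  trans (map-applyUpTo id (a +_) (suc b ∸ a)) (applyUpTo≗interval (a +_) a _ (λ _ → refl))

interval-++ : ∀ lo a c {m} → lo + a ≡ m → interval lo (a + suc c) ≡ interval lo a ++ m ∷ interval (suc m) c
interval-++ lo zero    c refl rewrite +-identityʳ lo = refl
interval-++ lo (suc a) c refl = cong (lo ∷_) (interval-++ (suc lo) a c (sym (+-suc lo a)))

length-interval : ∀ lo l → length (interval lo l) ≡ l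
length-interval lo zero    = refl
length-interval lo (suc l) = cong suc (length-interval (suc lo) l)

∈-interval⁺ : ∀ {x lo} l → lo ≤ x → x < lo + l → x ∈ interval lo l
∈-interval⁺ {x} {lo} zero    lo≤x x<lo+0 = contradiction (subst (x <_) (+-identityʳ lo) x<lo+0) (≤⇒≯ lo≤x)
∈-interval⁺ {x} {lo} (suc l) lo≤x x<     with m≤n⇒m<n∨m≡n lo≤x
... | inj₂ refl = here refl
... | inj₁ lo<x = there (∈-interval⁺ l lo<x (subst (x <_) (+-suc lo l) x<))

∈-interval⁻ : ∀ {x} lo l → x ∈ interval lo l → lo ≤ x × x < lo + l
∈-interval⁻ lo (suc l) (here refl) = ≤-refl , subst (lo <_) (sym (+-suc lo l)) (s≤s (m≤m+n lo l))
∈-interval⁻ {x} lo (suc l) (there x∈) with ∈-interval⁻ (suc lo) l x∈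
... | lo<x , x< = <⇒≤ lo<x , subst (x <_) (sym (+-suc lo l)) x<

∈-range⁺ : ∀ {i n} → i ≤ n → i ∈ range 0 n
∈-range⁺ {i} {n} i≤n = subst (i ∈_) (sym (range≡interval 0 n)) (∈-interval⁺ (suc n) z≤n (s≤s i≤n))

∈-range⁻ : ∀ {i} n → i ∈ range 0 n → i ≤ n
∈-range⁻ {i} n i∈ = ≤-pred (proj₂ (∈-interval⁻ 0 (suc n) (subst (i ∈_) (range≡interval 0 n) i∈)))

length-range : ∀ n → length (range 0 n) ≡ suc n
length-range n = trans (cong length (range≡interval 0 n)) (length-interval 0 (suc n))

allB-true⁺ : ∀ (g : ℕ → Bool) {xs} → All (λ x → g x ≡ true) xs → allB g xs ≡ true
allB-true⁺ g []         = refl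
allB-true⁺ g (gx ∷ gxs) = cong₂ _∧_ gx (allB-true⁺ g gxs)

allB-true⁻ : ∀ (g : ℕ → Bool) xs → allB g xs ≡ true → All (λ x → g x ≡ true) xs
allB-true⁻ g []       _ = []
allB-true⁻ g (x ∷ xs) p with g x in gx
... | true  = gx ∷ allB-true⁻ g xs p
... | false = contradiction p λ ()

firstSat-++ : ∀ p xs {j} ys d → All (λ x → p x ≡ false) xs → p j ≡ true → firstSat p (xs ++ j ∷ ys) d ≡ j
firstSat-++ p []       ys d []         pj rewrite pj = refl
firstSat-++ p (x ∷ xs) ys d (px ∷ pxs) pj rewrite px = firstSat-++ p xs ys d pxs pj

smallest-≡ : ∀ p {a hi} → a ≤ hi → p a ≡ true → (∀ {x} → x < a → p x ≡ false) → smallest 0 hi p ≡ a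
smallest-≡ p {a} {hi} a≤hi pa below =
  begin
    firstSat p (range 0 hi) hi
  ≡⟨ cong (λ xs → firstSat p xs hi) split ⟩
    firstSat p (interval 0 a ++ a ∷ interval (suc a) (hi ∸ a)) hi
  ≡⟨ firstSat-++ p (interval 0 a) _ hi (All.tabulate (below ∘ proj₂ ∘ ∈-interval⁻ 0 a)) pa ⟩
    a
  ∎
  where
  open ≡-Reasoning
  split : range 0 hi ≡ interval 0 a ++ a ∷ interval (suc a) (hi ∸ a)
  split = trans (range≡interval 0 hi)
    (trans (cong (interval 0) (trans (cong suc (sym (m+[n∸m]≡n a≤hi))) (sym (+-suc a (hi ∸ a)))))
           (interval-++ 0 a (hi ∸ a) refl))

reverse-++-∷ : ∀ {A : Set} (xs : List A) y ys → reverse (xs ++ y ∷ ys) ≡ reverse ys ++ y ∷ reverse xs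
reverse-++-∷ xs y ys =
  trans (reverse-++ xs (y ∷ ys))
    (trans (cong (_++ reverse xs) (unfold-reverse y ys)) (++-assoc (reverse ys) (y ∷ []) (reverse xs)))

largest-≡ : ∀ p {lo a hi} → lo ≤ a → a ≤ hi → p a ≡ true → (∀ {x} → a < x → x ≤ hi → p x ≡ false) →
  largest lo hi p ≡ a
largest-≡ p {lo} {a} {hi} lo≤a a≤hi pa above =
  begin
    firstSat p (reverse (range lo hi)) lo
  ≡⟨ cong (λ xs → firstSat p (reverse xs) lo) split ⟩
    firstSat p (reverse (before ++ a ∷ after)) lo
  ≡⟨ cong (λ xs → firstSat p xs lo) (reverse-++-∷ before a after) ⟩
    firstSat p (reverse after ++ a ∷ reverse before) lo
  ≡⟨ firstSat-++ p (reverse after) _ lo (All.tabulate (bounded ∘ ∈-interval⁻ (suc a) (hi ∸ a) ∘ Any.reverse⁻)) pa ⟩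
    a
  ∎
  where
  open ≡-Reasoning
  before = interval lo (a ∸ lo)
  after  = interval (suc a) (hi ∸ a)
  size : suc hi ∸ lo ≡ (a ∸ lo) + suc (hi ∸ a)
  size = begin
    suc hi ∸ lo                           ≡⟨ cong (λ z → suc z ∸ lo) (sym (m+[n∸m]≡n a≤hi)) ⟩
    suc (a + (hi ∸ a)) ∸ lo               ≡⟨ cong (_∸ lo) (sym (+-suc a (hi ∸ a))) ⟩
    a + suc (hi ∸ a) ∸ lo                 ≡⟨ +-∸-comm (suc (hi ∸ a)) lo≤a ⟩
    (a ∸ lo) + suc (hi ∸ a)               ∎
  split : range lo hi ≡ before ++ a ∷ after
  split = trans (range≡interval lo hi)
    (trans (cong (interval lo) size) (interval-++ lo (a ∸ lo) (hi ∸ a) (m+[n∸m]≡n lo≤a)))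
  bounded : ∀ {x} → suc a ≤ x × x < suc a + (hi ∸ a) → p x ≡ false
  bounded {x} (a<x , x<) = above a<x (≤-pred (subst (x <_) (cong suc (m+[n∸m]≡n a≤hi)) x<))

-- The colour test local to allOf, which cannot be named outside Defs.
matches : Particle → Particle → Bool
matches x true  = x
matches x false = not x

matches-refl : ∀ x → matches x x ≡ true
matches-refl true  = refl
matches-refl false = refl

matches-not : ∀ x → matches x (not x) ≡ false
matches-not true  = refl
matches-not false = refl

allOf-step : ∀ x r a l → allOf x r a (a + l) ≡ matches x (cell r a) ∧ allOf x r (suc a) (a + l)
allOf-step x r a l
  rewrite range≡interval a (a + l) | range≡interval (suc a) (a + l)
        | trans (cong (_∸ a) (sym (+-suc a l))) (m+n∸m≡n a (suc l)) | m+n∸m≡n a l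
  with cell r a
... | true  = refl
... | false = refl

allOf-empty : ∀ x r a → allOf x r (suc a) a ≡ true
allOf-empty x r a rewrite n∸n≡0 a = refl

allOf-true-+ : ∀ x r a l → (∀ k → k ≤ l → cell r (a + k) ≡ x) → allOf x r a (a + l) ≡ true
allOf-true-+ x r a zero    h
  rewrite allOf-step x r a 0 | +-identityʳ a | allOf-empty x r a
        | subst (λ c → cell r c ≡ x) (+-identityʳ a) (h 0 z≤n) | matches-refl x = refl
allOf-true-+ x r a (suc l) h
  rewrite allOf-step x r a (suc l) | +-suc a l
        | allOf-true-+ x r (suc a) l (λ k k≤l → subst (λ c → cell r c ≡ x) (+-suc a k) (h (suc k) (s≤s k≤l)))
        | subst (λ c → cell r c ≡ x) (+-identityʳ a) (h 0 z≤n) | matches-refl x = refl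

allOf-false-+ : ∀ x r a l k → k ≤ l → cell r (a + k) ≡ not x → allOf x r a (a + l) ≡ false
allOf-false-+ x r a l zero _ h
  rewrite allOf-step x r a l | subst (λ c → cell r c ≡ not x) (+-identityʳ a) h | matches-not x = refl
allOf-false-+ x r a (suc l) (suc k) (s≤s k≤l) h
  rewrite allOf-step x r a (suc l) | +-suc a l
        | allOf-false-+ x r (suc a) l k k≤l (subst (λ c → cell r c ≡ not x) (+-suc a k) h) = ∧-zeroʳ _

allOf-true : ∀ x r {a b} → (∀ {c} → a ≤ c → c ≤ b → cell r c ≡ x) → allOf x r a b ≡ true
allOf-true x r {a} {b} h with a ≤? b
... | no a≰b rewrite m≤n⇒m∸n≡0 (≰⇒> a≰b) = refl
... | yes a≤b = subst (λ z → allOf x r a z ≡ true) (m+[n∸m]≡n a≤b)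
  (allOf-true-+ x r a (b ∸ a) λ k k≤ → h (m≤m+n a k) (subst (a + k ≤_) (m+[n∸m]≡n a≤b) (+-monoʳ-≤ a k≤)))

allOf-false : ∀ x r {a b c} → a ≤ c → c ≤ b → cell r c ≡ not x → allOf x r a b ≡ false
allOf-false x r {a} {b} {c} a≤c c≤b h =
  subst (λ z → allOf x r a z ≡ false) (m+[n∸m]≡n (≤-trans a≤c c≤b))
    (allOf-false-+ x r a (b ∸ a) (c ∸ a) (∸-monoˡ-≤ a c≤b) (subst (λ z → cell r z ≡ not x) (sym (m+[n∸m]≡n a≤c)) h))

cell-++-∷ : ∀ A x B {c} → c ≡ suc (length A) → cell (A ++ x ∷ B) c ≡ x
cell-++-∷ []           x B refl = refl
cell-++-∷ (a ∷ [])     x B refl = refl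
cell-++-∷ (a ∷ a' ∷ A) x B refl = cell-++-∷ (a' ∷ A) x B refl

cell-++-++-∷ : ∀ A B x C {c} → c ≡ suc (length A + length B) → cell (A ++ B ++ x ∷ C) c ≡ x
cell-++-++-∷ A B x C {c} c≡ rewrite sym (++-assoc A B (x ∷ C)) =
  cell-++-∷ (A ++ B) x C (trans c≡ (cong suc (sym (length-++ A))))

cell-replicate : ∀ A m x B {c} → length A < c → c ≤ length A + m → cell (A ++ replicate m x ++ B) c ≡ x
cell-replicate []      (suc m) x B {suc zero}    _       _         = refl
cell-replicate []      (suc m) x B {suc (suc c)} _       (s≤s c≤m) = cell-replicate [] m x B (s≤s z≤n) c≤m
cell-replicate []      zero    x B {suc c}       _       ()
cell-replicate (a ∷ A) m       x B {suc (suc c)} (s≤s A<) (s≤s c≤) = cell-replicate A m x B A< c≤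
cell-replicate (a ∷ A) m       x B {suc zero}    (s≤s ()) _

removeAt-++-∷ : ∀ A x B {p} → p ≡ suc (length A) → removeAt p (A ++ x ∷ B) ≡ A ++ B
removeAt-++-∷ []           x B refl = refl
removeAt-++-∷ (a ∷ [])     x B refl = refl
removeAt-++-∷ (a ∷ a' ∷ A) x B refl = cong (a ∷_) (removeAt-++-∷ (a' ∷ A) x B refl)

insertAt-++ : ∀ A y B {p} → p ≡ suc (length A) → insertAt p y (A ++ B) ≡ A ++ y ∷ B
insertAt-++ []      y B refl = refl
insertAt-++ (a ∷ A) y B refl = cong (a ∷_) (insertAt-++ A y B refl)

++-∷ʳ-++ : ∀ (A B : List Particle) x C → (A ++ B ∷ʳ x) ++ C ≡ A ++ B ++ x ∷ C
++-∷ʳ-++ A B x C = trans (++-assoc A (B ∷ʳ x) C) (cong (A ++_) (++-assoc B (x ∷ []) C))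

length-++-++-∷ : ∀ (A B : List Particle) y C → length (A ++ B ++ y ∷ C) ≡ suc (length A + length B + length C)
length-++-++-∷ A B y C
  rewrite length-++ A {B ++ y ∷ C} | length-++ B {y ∷ C} = arith (length A) (length B) (length C)
  where
  arith : ∀ a b c → a + (b + suc c) ≡ suc (a + b + c)
  arith = solve-∀

length-++-∷ʳ : ∀ (A B : List Particle) x → length (A ++ B ∷ʳ x) ≡ suc (length A + length B)
length-++-∷ʳ A B x = trans (length-++-++-∷ A B x []) (cong suc (+-identityʳ _))

length-∷ʳ : ∀ (A : List Particle) x → length (A ∷ʳ x) ≡ suc (length A)
length-∷ʳ A x = trans (length-++ A) (+-comm (length A) 1)

∷ʳ-length-injective : ∀ A B {x y} → length (A ∷ʳ x) ≡ length (B ∷ʳ y) → length A ≡ length B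
∷ʳ-length-injective A B {x} {y} eq = suc-injective (trans (sym (length-∷ʳ A x)) (trans eq (length-∷ʳ B y)))

cell-++-∷ʳ : ∀ A B x C {c} → c ≡ suc (length A + length B) → cell ((A ++ B ∷ʳ x) ++ C) c ≡ x
cell-++-∷ʳ A B x C c≡ = trans (cong (λ L → cell L _) (++-∷ʳ-++ A B x C)) (cell-++-++-∷ A B x C c≡)

insertAt-∷ʳ : ∀ A y {p} → p ≡ suc (length A) → insertAt p y A ≡ A ∷ʳ y
insertAt-∷ʳ A y p≡ = trans (cong (insertAt _ y) (sym (++-identityʳ A))) (insertAt-++ A y [] p≡)

replicate-∷ʳ : ∀ s (x : Particle) → replicate s x ∷ʳ x ≡ replicate (suc s) x
replicate-∷ʳ zero    x = refl
replicate-∷ʳ (suc s) x = cong (x ∷_) (replicate-∷ʳ s x)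

insertAt-++-++ : ∀ A B y C {p} → p ≡ suc (length A + length B) → insertAt p y (A ++ B ++ C) ≡ A ++ B ++ y ∷ C
insertAt-++-++ A B y C p≡ rewrite sym (++-assoc A B C) =
  trans (insertAt-++ (A ++ B) y C (trans p≡ (cong suc (sym (length-++ A))))) (++-assoc A B (y ∷ C))

replicate-suc-++ : ∀ s (x : Particle) L → replicate (suc s) x ++ L ≡ replicate s x ++ x ∷ L
replicate-suc-++ zero    x L = refl
replicate-suc-++ (suc s) x L = cong (x ∷_) (replicate-suc-++ s x L)

removeAt-++-++-∷ : ∀ A B x C {p} → p ≡ suc (length A + length B) → removeAt p (A ++ B ++ x ∷ C) ≡ A ++ B ++ C
removeAt-++-++-∷ A B x C p≡ rewrite sym (++-assoc A B (x ∷ C)) =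
  trans (removeAt-++-∷ (A ++ B) x C (trans p≡ (cong suc (sym (length-++ A))))) (++-assoc A B C)

data EmptyOrEndsWith (x : Particle) : List Particle → Set where
  empty : EmptyOrEndsWith x []
  snoc  : ∀ L → EmptyOrEndsWith x (L ∷ʳ x)

data EmptyOrStartsWith (x : Particle) : List Particle → Set where
  empty : EmptyOrStartsWith x []
  cons  : ∀ L → EmptyOrStartsWith x (x ∷ L)

-- T's searches j₁ and j₂: whiteRunStart t i is the wall just before the run of ∘ ending at cell i,
-- blackRunEnd n t i the last cell of the run of • starting at cell i + 1.
whiteRunStart : List Particle → ℕ → ℕ
whiteRunStart t i = smallest 0 i (λ j → allOf white t (suc j) i)

blackRunEnd : ℕ → List Particle → ℕ → ℕ
blackRunEnd n t i = largest i n (λ j → allOf black t (suc i) j)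

whiteRunStart-≡ : ∀ tP m rest {hi} → EmptyOrEndsWith black tP → length tP ≤ hi → hi ≤ length tP + m →
  whiteRunStart (tP ++ replicate m white ++ rest) hi ≡ length tP
whiteRunStart-≡ tP m rest {hi} ends k≤hi hi≤ = smallest-≡ _ k≤hi run-white (left-black ends)
  where
  t = tP ++ replicate m white ++ rest
  run-white : allOf white t (suc (length tP)) hi ≡ true
  run-white = allOf-true white t λ k<c c≤hi → cell-replicate tP m white rest k<c (≤-trans c≤hi hi≤)
  left-black : EmptyOrEndsWith black tP → ∀ {x} → x < length tP → allOf white t (suc x) hi ≡ false
  left-black (snoc L) x<k = allOf-false white t x<k k≤hi
    (trans (cong₂ cell (++-assoc L (black ∷ []) _) (length-++ L)) (cell-++-∷ L black _ (+-comm (length L) 1)))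

blackRunEnd-≡ : ∀ W s tS {hi} → EmptyOrStartsWith white tS → hi ≡ length (W ++ replicate s black ++ tS) →
  blackRunEnd hi (W ++ replicate s black ++ tS) (length W) ≡ length W + s
blackRunEnd-≡ W s tS {hi} starts refl = largest-≡ _ (m≤m+n (length W) s) end≤hi run-black (right-white starts)
  where
  t = W ++ replicate s black ++ tS
  length-t : length t ≡ length W + s + length tS
  length-t = trans (length-++ W)
    (trans (cong (length W +_) (trans (length-++ (replicate s black)) (cong (_+ length tS) (length-replicate s))))
           (sym (+-assoc (length W) s (length tS))))
  end≤hi : length W + s ≤ length t
  end≤hi = subst (length W + s ≤_) (sym length-t) (m≤m+n (length W + s) (length tS))
  run-black : allOf black t (suc (length W)) (length W + s) ≡ true
  run-black = allOf-true black t λ W<c c≤ → cell-replicate W s black tS W<c c≤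
  right-white : EmptyOrStartsWith white tS → ∀ {x} → length W + s < x → x ≤ length t →
    allOf black t (suc (length W)) x ≡ false
  right-white empty        end<x x≤ = contradiction (subst (_ ≤_) (trans length-t (+-identityʳ _)) x≤) (<⇒≱ end<x)
  right-white (cons L) end<x x≤ = allOf-false black t (s≤s (m≤m+n (length W) s)) end<x
    (cell-++-++-∷ W (replicate s black) white L (cong (λ z → suc (length W + z)) (sym (length-replicate s))))

blackRunEnd-≡-end : ∀ W s {hi} → hi ≡ length (W ++ replicate s black) →
  blackRunEnd hi (W ++ replicate s black) (length W) ≡ length W + s
blackRunEnd-≡-end W s {hi} hi≡ =
  trans (cong (λ L → blackRunEnd hi (W ++ L) (length W)) (sym (++-identityʳ (replicate s black))))
        (blackRunEnd-≡ W s [] empty (trans hi≡ (cong (λ L → length (W ++ L)) (sym (++-identityʳ _)))))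

data LeadingRun (x : Particle) : List Particle → Set where
  whole : ∀ m → LeadingRun x (replicate m x)
  stop  : ∀ m L → LeadingRun x (replicate m x ++ not x ∷ L)

leadingRun : ∀ x L → LeadingRun x L
leadingRun x     []          = whole 0
leadingRun true  (false ∷ L) = stop 0 L
leadingRun false (true ∷ L)  = stop 0 L
leadingRun true  (true ∷ L)  with leadingRun true L
... | whole m   = whole (suc m)
... | stop m L′ = stop (suc m) L′
leadingRun false (false ∷ L) with leadingRun false L
... | whole m   = whole (suc m)
... | stop m L′ = stop (suc m) L′

data TrailingRun (x : Particle) : List Particle → Set where
  whole : ∀ m → TrailingRun x (replicate m x)
  stop  : ∀ U m → TrailingRun x (U ++ not x ∷ replicate m x)

consRun : ∀ x y {L} → TrailingRun x L → TrailingRun x (y ∷ L)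
consRun x     y     (stop U m) = stop (y ∷ U) m
consRun true  true  (whole m)  = whole (suc m)
consRun true  false (whole m)  = stop [] m
consRun false false (whole m)  = whole (suc m)
consRun false true  (whole m)  = stop [] m

trailingRun : ∀ x L → TrailingRun x L
trailingRun x []      = whole 0
trailingRun x (y ∷ L) = consRun x y (trailingRun x L)

data SplitLike (A B : List Particle) : List Particle → Set where
  split : ∀ A′ B′ → length A ≡ length A′ → length B ≡ length B′ → SplitLike A B (A′ ++ B′)

splitLike : ∀ A B C → length (A ++ B) ≡ length C → SplitLike A B C
splitLike []      B C       len = split [] C refl len
splitLike (a ∷ A) B (c ∷ C) len with splitLike A B C (suc-injective len)
... | split A′ B′ lA lB = split (c ∷ A′) B′ (cong suc lA) lB

data ColumnSplit (k : ℕ) : List Particle → List Particle → Set where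
  split : ∀ tP u tR bP v bR → length tP ≡ k → length tP ≡ length bP → length tR ≡ length bR →
          ColumnSplit k (tP ++ u ∷ tR) (bP ++ v ∷ bR)

columnSplit : ∀ k t b → k < length t → length t ≡ length b → ColumnSplit k t b
columnSplit zero    (u ∷ t) (v ∷ b) _        len = split [] u t [] v b refl refl (suc-injective len)
columnSplit (suc k) (x ∷ t) (y ∷ b) (s≤s k<) len with columnSplit k t b k< (suc-injective len)
... | split tP u tR bP v bR lP lPB lR = split (x ∷ tP) u tR (y ∷ bP) v bR (cong suc lP) (cong suc lPB) lR

-- Complete configurations as lattice paths

count-++ : ∀ x A B → count x (A ++ B) ≡ count x A + count x B
count-++ x     []          B = refl
count-++ true  (true ∷ A)  B = cong suc (count-++ true A B)
count-++ true  (false ∷ A) B = count-++ true A B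
count-++ false (true ∷ A)  B = count-++ false A B
count-++ false (false ∷ A) B = cong suc (count-++ false A B)

count-black+white : ∀ A → count black A + count white A ≡ length A
count-black+white []          = refl
count-black+white (true ∷ A)  = cong suc (count-black+white A)
count-black+white (false ∷ A) = trans (+-suc (count black A) (count white A)) (cong suc (count-black+white A))

take-length : ∀ {j} (A : List Particle) → length A ≤ j → take j A ≡ A
take-length {zero}  []      _         = refl
take-length {suc j} []      _         = refl
take-length {suc j} (x ∷ A) (s≤s A≤j) = cong (x ∷_) (take-length A A≤j)

-- Path h t b e: reading the columns of (t , b) from the left, starting at height h, each column
-- adds its number of • minus its number of ∘; the height stays ≥ 0 and ends at e.
data Path : ℕ → List Particle → List Particle → ℕ → Set where
  []  : ∀ {h} → Path h [] [] h
  bb  : ∀ {h t b e} → Path (suc (suc h)) t b e → Path h (black ∷ t) (black ∷ b) e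
  bw  : ∀ {h t b e} → Path h t b e → Path h (black ∷ t) (white ∷ b) e
  wb  : ∀ {h t b e} → Path h t b e → Path h (white ∷ t) (black ∷ b) e
  ww  : ∀ {h t b e} → Path h t b e → Path (suc (suc h)) (white ∷ t) (white ∷ b) e

countPrefix : Particle → List Particle → List Particle → ℕ → ℕ
countPrefix x t b j = count x (take j t) + count x (take j b)

PrefixCondition : ℕ → List Particle → List Particle → Set
PrefixCondition h t b = ∀ j → countPrefix white t b j ≤ h + countPrefix black t b j

Balanced : ℕ → List Particle → List Particle → ℕ → Set
Balanced h t b e = h + (count black t + count black b) ≡ e + (count white t + count white b)

private
  +-suc-suc : ∀ m n → suc m + suc n ≡ suc (suc (m + n))
  +-suc-suc = solve-∀

  +-+-suc-suc : ∀ h m n → h + (suc m + suc n) ≡ suc (suc (h + (m + n)))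
  +-+-suc-suc = solve-∀

  +-+-suc : ∀ h m n → h + (m + suc n) ≡ suc (h + (m + n))
  +-+-suc = solve-∀

path⇒ : ∀ {h t b e} → Path h t b e → PrefixCondition h t b × Balanced h t b e
path⇒ []                  = (λ { zero → z≤n ; (suc j) → z≤n }) , refl
path⇒ {h} {e = e} (bb p) with path⇒ p
... | prefix , balance =
  (λ { zero → z≤n ; (suc j) → ≤-trans (prefix j) (≤-reflexive (sym (+-+-suc-suc h _ _))) }) ,
  trans (+-+-suc-suc h _ _) balance
path⇒ {h} {e = e} (bw p) with path⇒ p
... | prefix , balance =
  (λ { zero → z≤n
      ; (suc j) → ≤-trans (≤-reflexive (+-suc _ _)) (≤-trans (s≤s (prefix j)) (≤-reflexive (sym (+-suc h _)))) }) ,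
  trans (+-suc h _) (trans (cong suc balance) (sym (+-+-suc e _ _)))
path⇒ {h} {e = e} (wb p) with path⇒ p
... | prefix , balance =
  (λ { zero → z≤n ; (suc j) → ≤-trans (s≤s (prefix j)) (≤-reflexive (sym (+-+-suc h _ _))) }) ,
  trans (+-+-suc h _ _) (trans (cong suc balance) (sym (+-suc e _)))
path⇒ {e = e} (ww p) with path⇒ p
... | prefix , balance =
  (λ { zero → z≤n ; (suc j) → ≤-trans (≤-reflexive (+-suc-suc _ _)) (s≤s (s≤s (prefix j))) }) ,
  trans (cong (suc ∘ suc) balance) (sym (+-+-suc-suc e _ _))

⇒path : ∀ {h} t b {e} → length t ≡ length b → PrefixCondition h t b → Balanced h t b e → Path h t b e
⇒path {h} [] [] {e} _ _ balance = subst (Path h [] []) (+-cancelʳ-≡ 0 h e balance) []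
⇒path {h} (true ∷ t) (true ∷ b) {e} len prefix balance =
  bb (⇒path t b (suc-injective len)
       (λ j → ≤-trans (prefix (suc j)) (≤-reflexive (+-+-suc-suc h _ _)))
       (trans (sym (+-+-suc-suc h _ _)) balance))
⇒path {h} (true ∷ t) (false ∷ b) {e} len prefix balance =
  bw (⇒path t b (suc-injective len)
       (λ j → ≤-pred (≤-trans (≤-reflexive (sym (+-suc _ _))) (≤-trans (prefix (suc j)) (≤-reflexive (+-suc h _)))))
       (suc-injective (trans (sym (+-suc h _)) (trans balance (+-+-suc e _ _)))))
⇒path {h} (false ∷ t) (true ∷ b) {e} len prefix balance =
  wb (⇒path t b (suc-injective len)
       (λ j → ≤-pred (≤-trans (prefix (suc j)) (≤-reflexive (+-+-suc h _ _))))
       (suc-injective (trans (sym (+-+-suc h _ _)) (trans balance (+-suc e _)))))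
⇒path {zero} (false ∷ t) (false ∷ b) len prefix balance with prefix 1
... | ()
⇒path {suc zero} (false ∷ t) (false ∷ b) len prefix balance with prefix 1
... | s≤s ()
⇒path {suc (suc h)} (false ∷ t) (false ∷ b) {e} len prefix balance =
  ww (⇒path t b (suc-injective len)
       (λ j → ≤-pred (≤-pred (≤-trans (≤-reflexive (sym (+-suc-suc _ _))) (prefix (suc j)))))
       (suc-injective (suc-injective (trans balance (+-+-suc-suc e _ _)))))

prefixChecked : List Particle → List Particle → ℕ → Bool
prefixChecked t b j = count white (take j t ++ take j b) ≤ᵇ count black (take j t ++ take j b)

prefixChecked⇒ : ∀ t b j → prefixChecked t b j ≡ true → countPrefix white t b j ≤ countPrefix black t b j
prefixChecked⇒ t b j ok =
  subst₂ _≤_ (count-++ white (take j t) (take j b)) (count-++ black (take j t) (take j b))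
    (≤ᵇ⇒≤ _ _ (Equivalence.from T-≡ ok))

countPrefix-full : ∀ x t b {j} → length t ≤ j → length b ≤ j → countPrefix x t b j ≡ count x t + count x b
countPrefix-full x t b t≤j b≤j = cong₂ _+_ (cong (count x) (take-length t t≤j)) (cong (count x) (take-length b b≤j))

checked⇒prefixCondition : ∀ n t b → length t ≡ n → length b ≡ n →
  allB (prefixChecked t b) (range 0 n) ≡ true → PrefixCondition 0 t b
checked⇒prefixCondition n t b lt lb checks j with j ≤? n
... | yes j≤n = prefixChecked⇒ t b j (All.lookup (allB-true⁻ (prefixChecked t b) (range 0 n) checks) (∈-range⁺ j≤n))
... | no  j≰n = subst₂ _≤_ (stable white) (stable black)
                  (prefixChecked⇒ t b n (All.lookup (allB-true⁻ (prefixChecked t b) (range 0 n) checks) (∈-range⁺ ≤-refl)))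
  where
  n≤j = <⇒≤ (≰⇒> j≰n)
  stable : ∀ x → countPrefix x t b n ≡ countPrefix x t b j
  stable x = trans (countPrefix-full x t b (≤-reflexive lt) (≤-reflexive lb))
                   (sym (countPrefix-full x t b (≤-trans (≤-reflexive lt) n≤j) (≤-trans (≤-reflexive lb) n≤j)))

complete⇒path : ∀ n t b → isComplete n (t , b) ≡ true → length t ≡ n × length b ≡ n × Path 0 t b 0
complete⇒path n t b complete with ∧-true⁻ complete
... | lt , c₁ with ∧-true⁻ c₁
... | lb , c₂ with ∧-true⁻ c₂
... | blacks , c₃ with ∧-true⁻ c₃
... | whites , checks =
  ≡ᵇ-true⁻ lt , ≡ᵇ-true⁻ lb ,
  ⇒path t b (trans (≡ᵇ-true⁻ lt) (sym (≡ᵇ-true⁻ lb)))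
    (checked⇒prefixCondition n t b (≡ᵇ-true⁻ lt) (≡ᵇ-true⁻ lb) checks)
    (trans (sym (count-++ black t b)) (trans (≡ᵇ-true⁻ blacks) (trans (sym (≡ᵇ-true⁻ whites)) (count-++ white t b))))

halve : ∀ {m n} → m + m ≡ n + n → m ≡ n
halve {m} {n} eq = trans (n≡⌊n+n/2⌋ m) (trans (cong ⌊_/2⌋ eq) (sym (n≡⌊n+n/2⌋ n)))

path⇒complete : ∀ n t b → length t ≡ n → length b ≡ n → Path 0 t b 0 → isComplete n (t , b) ≡ true
path⇒complete n t b lt lb p =
  cong₂ _∧_ (≡ᵇ-true⁺ lt) (cong₂ _∧_ (≡ᵇ-true⁺ lb)
    (cong₂ _∧_ (≡ᵇ-true⁺ (trans (count-++ black t b) B≡n))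
      (cong₂ _∧_ (≡ᵇ-true⁺ (trans (count-++ white t b) (trans (sym B≡W) B≡n))) checks)))
  where
  B = count black t + count black b
  W = count white t + count white b
  B≡W : B ≡ W
  B≡W = proj₂ (path⇒ p)
  B+W : B + W ≡ n + n
  B+W = trans (interchange (count black t) (count black b) (count white t) (count white b))
              (cong₂ _+_ (trans (count-black+white t) lt) (trans (count-black+white b) lb))
  B≡n : B ≡ n
  B≡n = halve (trans (cong (B +_) B≡W) B+W)
  checks : allB (prefixChecked t b) (range 0 n) ≡ true
  checks = allB-true⁺ (prefixChecked t b) {range 0 n} (All.tabulate λ {j} _ → Equivalence.to T-≡ (≤⇒≤ᵇ
    (subst₂ _≤_ (sym (count-++ white (take j t) (take j b))) (sym (count-++ black (take j t) (take j b)))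
      (proj₁ (path⇒ p) j))))

Path-under : ∀ A B {h S R S′ R′ e} → length A ≡ length B → (∀ {m} → Path m S R e → Path m S′ R′ e) →
  Path h (A ++ S) (B ++ R) e → Path h (A ++ S′) (B ++ R′) e
Path-under []      []      _   f p      = f p
Path-under (_ ∷ A) (_ ∷ B) len f (bb p) = bb (Path-under A B (suc-injective len) f p)
Path-under (_ ∷ A) (_ ∷ B) len f (bw p) = bw (Path-under A B (suc-injective len) f p)
Path-under (_ ∷ A) (_ ∷ B) len f (wb p) = wb (Path-under A B (suc-injective len) f p)
Path-under (_ ∷ A) (_ ∷ B) len f (ww p) = ww (Path-under A B (suc-injective len) f p)

insertNeutral : ∀ u {m S R e} → Path m S R e → Path m (u ∷ S) (not u ∷ R) e
insertNeutral true  = bw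
insertNeutral false = wb

deleteNeutral : ∀ u {m S R e} → Path m (u ∷ S) (not u ∷ R) e → Path m S R e
deleteNeutral true  (bw p) = p
deleteNeutral false (wb p) = p

mergeColumns : ∀ z {m S R e} → Path m (black ∷ white ∷ S) (z ∷ white ∷ R) e → Path m (white ∷ S) (z ∷ R) e
mergeColumns true  (bb (ww p)) = wb p
mergeColumns false (bw (ww p)) = ww p

splitColumn : ∀ {y m S R e} → Path m (white ∷ S) (y ∷ R) e → Path m (black ∷ white ∷ S) (y ∷ white ∷ R) e
splitColumn (wb p) = bb (ww p)
splitColumn (ww p) = bw (ww p)

appendNeutral : ∀ A B u {h e} → length A ≡ length B → Path h A B e → Path h (A ∷ʳ u) (B ∷ʳ not u) e
appendNeutral A B u {h} {e} len p =
  Path-under A B len (insertNeutral u) (subst₂ (λ X Y → Path h X Y e) (sym (++-identityʳ A)) (sym (++-identityʳ B)) p)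

dropLastNeutral : ∀ A B u {h e} → length A ≡ length B → Path h (A ∷ʳ u) (B ∷ʳ not u) e → Path h A B e
dropLastNeutral A B u {h} {e} len p =
  subst₂ (λ X Y → Path h X Y e) (++-identityʳ A) (++-identityʳ B) (Path-under A B len (deleteNeutral u) p)

¬Path-ending-bb : ∀ A B {h} → length A ≡ length B → ¬ Path h (A ∷ʳ black) (B ∷ʳ black) 0
¬Path-ending-bb []      []      _   (bb ())
¬Path-ending-bb (_ ∷ A) (_ ∷ B) len (bb p) = ¬Path-ending-bb A B (suc-injective len) p
¬Path-ending-bb (_ ∷ A) (_ ∷ B) len (bw p) = ¬Path-ending-bb A B (suc-injective len) p
¬Path-ending-bb (_ ∷ A) (_ ∷ B) len (wb p) = ¬Path-ending-bb A B (suc-injective len) p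
¬Path-ending-bb (_ ∷ A) (_ ∷ B) len (ww p) = ¬Path-ending-bb A B (suc-injective len) p

afterOrLast : ℕ → ℕ → ℕ
afterOrLast n j = if j <ᵇ n then suc j else n

T-a′ : ∀ n t b {i} → 0 < i → i < n → cell t i ≡ black → cell t (suc i) ≡ white → cell b (suc i) ≡ black →
  T n (t , b) i ≡ ( insertAt (suc (whiteRunStart t (i ∸ 1))) white (removeAt (suc i) t)
                  , insertAt (suc (whiteRunStart t (i ∸ 1))) black (removeAt (suc i) b))
T-a′ n t b {i} 0<i i<n tᵢ tᵢ₊₁ bᵢ₊₁
  rewrite ≡ᵇ-false⁺ (>⇒≢ 0<i) | ≡ᵇ-false⁺ (<⇒≢ i<n) | <ᵇ-true⁺ i<n | tᵢ | tᵢ₊₁ | bᵢ₊₁ = refl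

T-a″ : ∀ n t b {i} → 0 < i → i < n → cell t i ≡ black → cell t (suc i) ≡ white → cell b (suc i) ≡ white →
  T n (t , b) i ≡ ( insertAt (blackRunEnd n t (suc i)) black (removeAt i t)
                  , insertAt (afterOrLast n (blackRunEnd n t (suc i))) white (removeAt (suc i) b))
T-a″ n t b {i} 0<i i<n tᵢ tᵢ₊₁ bᵢ₊₁
  rewrite ≡ᵇ-false⁺ (>⇒≢ 0<i) | ≡ᵇ-false⁺ (<⇒≢ i<n) | <ᵇ-true⁺ i<n | tᵢ | tᵢ₊₁ | bᵢ₊₁ = refl

T-b : ∀ n t b → cell t 1 ≡ white →
  T n (t , b) 0 ≡ ( insertAt (blackRunEnd n t 1) black (removeAt 1 t)
                  , insertAt (afterOrLast n (blackRunEnd n t 1)) white (removeAt 1 b))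
T-b n t b t₁ rewrite t₁ = refl

T-c : ∀ n t b → 0 < n → cell t n ≡ black →
  T n (t , b) n ≡ ( insertAt (suc (whiteRunStart t (n ∸ 1))) white (removeAt n t)
                  , insertAt (suc (whiteRunStart t (n ∸ 1))) black (removeAt n b))
T-c n t b 0<n tₙ rewrite ≡ᵇ-false⁺ (>⇒≢ 0<n) | ≡ᵇ-true⁺ {n} refl | tₙ = refl

T-loop-0 : ∀ n t b → cell t 1 ≡ black → T n (t , b) 0 ≡ (t , b)
T-loop-0 n t b t₁ rewrite t₁ = refl

T-loop-n : ∀ n t b → 0 < n → cell t n ≡ white → T n (t , b) n ≡ (t , b)
T-loop-n n t b 0<n tₙ rewrite ≡ᵇ-false⁺ (>⇒≢ 0<n) | ≡ᵇ-true⁺ {n} refl | tₙ = refl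

T-loop : ∀ n t b {i} → 0 < i → i < n → (cell t i ∧ not (cell t (suc i))) ≡ false → T n (t , b) i ≡ (t , b)
T-loop n t b {i} 0<i i<n ¬• rewrite ≡ᵇ-false⁺ (>⇒≢ 0<i) | ≡ᵇ-false⁺ (<⇒≢ i<n) | <ᵇ-true⁺ i<n | ¬• = refl

eqRow-sound : ∀ x y → eqRow x y ≡ true → x ≡ y
eqRow-sound []          []          _ = refl
eqRow-sound (true ∷ x)  (true ∷ y)  p = cong (true ∷_) (eqRow-sound x y p)
eqRow-sound (false ∷ x) (false ∷ y) p = cong (false ∷_) (eqRow-sound x y p)
eqRow-sound []          (true ∷ y)  ()
eqRow-sound []          (false ∷ y) ()
eqRow-sound (true ∷ x)  []          ()
eqRow-sound (false ∷ x) []          ()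
eqRow-sound (true ∷ x)  (false ∷ y) ()
eqRow-sound (false ∷ x) (true ∷ y)  ()

eqRow-refl : ∀ x → eqRow x x ≡ true
eqRow-refl []          = refl
eqRow-refl (true ∷ x)  = eqRow-refl x
eqRow-refl (false ∷ x) = eqRow-refl x

eqConfig-refl : ∀ ω → eqConfig ω ω ≡ true
eqConfig-refl (t , b) rewrite eqRow-refl t | eqRow-refl b = refl

eqConfig-sound : ∀ ω ω′ → eqConfig ω ω′ ≡ true → ω ≡ ω′
eqConfig-sound (t , b) (t′ , b′) p with ∧-true⁻ p
... | tt′ , bb′ = cong₂ _,_ (eqRow-sound t t′ tt′) (eqRow-sound b b′ bb′)

eqConfig-false : ∀ t b t′ b′ {x} c → cell t c ≡ x → cell t′ c ≡ not x → eqConfig (t , b) (t′ , b′) ≡ false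
eqConfig-false t b t′ b′ c tc t′c with eqConfig (t , b) (t′ , b′) in eq
... | false = refl
... | true  = contradiction
  (trans (sym tc) (trans (cong (λ ω → cell (proj₁ ω) c) (eqConfig-sound (t , b) (t′ , b′) eq)) t′c)) (not-¬ refl)

-- A move (ω , i) into ω′ ≠ ω is labelled by the insertion wall j₁ or j₂ that T used, recomputed
-- from ω′ as an end of a maximal run of ∘ or • in its top row; a loop is labelled by its wall.
label : ℕ → Config → Config → ℕ → ℕ
label n (t′ , b′) (t , b) i =
  if eqConfig (t , b) (t′ , b′) then i
  else if i ≡ᵇ n then whiteRunStart t′ n
  else if i ≡ᵇ 0 then blackRunEnd n t′ 0
  else if cell b (suc i) then whiteRunStart t′ i
  else blackRunEnd n t′ i

label-loop : ∀ n ω i → label n ω ω i ≡ i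
label-loop n ω i rewrite eqConfig-refl ω = refl

label-a′ : ∀ n t′ b′ t b {i} → eqConfig (t , b) (t′ , b′) ≡ false → 0 < i → i < n → cell b (suc i) ≡ black →
  label n (t′ , b′) (t , b) i ≡ whiteRunStart t′ i
label-a′ n t′ b′ t b moved 0<i i<n bᵢ₊₁
  rewrite moved | ≡ᵇ-false⁺ (<⇒≢ i<n) | ≡ᵇ-false⁺ (>⇒≢ 0<i) | bᵢ₊₁ = refl

label-a″ : ∀ n t′ b′ t b {i} → eqConfig (t , b) (t′ , b′) ≡ false → 0 < i → i < n → cell b (suc i) ≡ white →
  label n (t′ , b′) (t , b) i ≡ blackRunEnd n t′ i
label-a″ n t′ b′ t b moved 0<i i<n bᵢ₊₁
  rewrite moved | ≡ᵇ-false⁺ (<⇒≢ i<n) | ≡ᵇ-false⁺ (>⇒≢ 0<i) | bᵢ₊₁ = refl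

label-b : ∀ n t′ b′ t b → eqConfig (t , b) (t′ , b′) ≡ false → 0 < n →
  label n (t′ , b′) (t , b) 0 ≡ blackRunEnd n t′ 0
label-b n t′ b′ t b moved 0<n rewrite moved | ≡ᵇ-false⁺ (<⇒≢ 0<n) = refl

label-c : ∀ n t′ b′ t b → eqConfig (t , b) (t′ , b′) ≡ false → label n (t′ , b′) (t , b) n ≡ whiteRunStart t′ n
label-c n t′ b′ t b moved rewrite moved | ≡ᵇ-true⁺ {n} refl = refl

record Preimage (n : ℕ) (ω′ : Config) (k : ℕ) : Set where
  constructor preimage
  field
    source   : Config
    wall     : ℕ
    wall≤n   : wall ≤ n
    complete : isComplete n source ≡ true
    hits     : T n source wall ≡ ω′
    labelled : label n ω′ source wall ≡ k

Preimage-transport : ∀ {n k k′ t t′ b b′} → (Path 0 t b 0 → Preimage (length t) (t , b) k) →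
  t′ ≡ t → b′ ≡ b → length t′ ≡ n → k ≡ k′ → Path 0 t′ b′ 0 → Preimage n (t′ , b′) k′
Preimage-transport result refl refl refl refl p = result p

loop : ∀ n ω k → k ≤ n → isComplete n ω ≡ true → T n ω k ≡ ω → Preimage n ω k
loop n ω k k≤n complete fixed = preimage ω k k≤n complete fixed (label-loop n ω k)

-- Each module below inverts one case of T: from a decomposition of ω′ = (t′ , b′) around wall k it
-- builds a complete ω = (t , b) and a wall i with T ω i = ω′ and label k.
module MoveA′ (tP bP : List Particle) (m : ℕ) (bM : List Particle) (x : Particle) (tS bS : List Particle)
  (ends : EmptyOrEndsWith black tP) (lP : length tP ≡ length bP) (lM : length bM ≡ m) (lS : length tS ≡ length bS)
  where

  k s i n : ℕ
  k = length tP
  s = length tS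
  i = suc (k + m)

  topFront botFront t′ b′ t b : List Particle
  topFront = tP ++ replicate m white ∷ʳ black
  botFront = bP ++ bM ∷ʳ x
  t′ = tP ++ replicate (suc m) white ++ black ∷ tS
  b′ = bP ++ black ∷ bM ++ x ∷ bS
  t  = topFront ++ white ∷ tS
  b  = botFront ++ black ∷ bS

  n = length t′

  length-topFront : length topFront ≡ i
  length-topFront = trans (length-++-∷ʳ tP (replicate m white) black) (cong (λ z → suc (k + z)) (length-replicate m))

  length-botFront : length botFront ≡ i
  length-botFront = trans (length-++-∷ʳ bP bM x) (cong suc (cong₂ _+_ (sym lP) lM))

  length-t′ : n ≡ i + suc s
  length-t′ = trans (length-++-++-∷ tP (replicate (suc m) white) black tS)
                    (trans (cong (λ z → suc (k + z + s)) (length-replicate (suc m))) (arith k m s))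
    where
    arith : ∀ k m s → suc (k + suc m + s) ≡ suc (k + m) + suc s
    arith = solve-∀

  length-t : length t ≡ n
  length-t = trans (length-++ topFront) (trans (cong (_+ suc s) length-topFront) (sym length-t′))

  length-b : length b ≡ n
  length-b = trans (length-++ botFront) (trans (cong₂ (λ u v → u + suc v) length-botFront (sym lS)) (sym length-t′))

  i<n : i < n
  i<n = subst (i <_) (sym length-t′) (m<m+n i (s≤s z≤n))

  tᵢ : cell t i ≡ black
  tᵢ = cell-++-∷ʳ tP (replicate m white) black (white ∷ tS) (cong (λ z → suc (k + z)) (sym (length-replicate m)))

  tᵢ₊₁ : cell t (suc i) ≡ white
  tᵢ₊₁ = cell-++-∷ topFront white tS (cong suc (sym length-topFront))

  bᵢ₊₁ : cell b (suc i) ≡ black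
  bᵢ₊₁ = cell-++-∷ botFront black bS (cong suc (sym length-botFront))

  t′ᵢ : cell t′ i ≡ white
  t′ᵢ = cell-replicate tP (suc m) white (black ∷ tS) (s≤s (m≤m+n k m)) (≤-reflexive (sym (+-suc k m)))

  t-flat : t ≡ tP ++ replicate m white ++ black ∷ white ∷ tS
  t-flat = ++-∷ʳ-++ tP (replicate m white) black (white ∷ tS)

  j₁ : whiteRunStart t (i ∸ 1) ≡ k
  j₁ = trans (cong (λ L → whiteRunStart L (k + m)) t-flat)
             (whiteRunStart-≡ tP m (black ∷ white ∷ tS) ends (m≤m+n k m) ≤-refl)

  top : insertAt (suc k) white (removeAt (suc i) t) ≡ t′
  top = begin
    insertAt (suc k) white (removeAt (suc i) t)
      ≡⟨ cong (insertAt (suc k) white) (removeAt-++-∷ topFront white tS (cong suc (sym length-topFront))) ⟩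
    insertAt (suc k) white (topFront ++ tS)
      ≡⟨ cong (insertAt (suc k) white) (++-∷ʳ-++ tP (replicate m white) black tS) ⟩
    insertAt (suc k) white (tP ++ replicate m white ++ black ∷ tS)
      ≡⟨ insertAt-++ tP white _ refl ⟩
    t′ ∎
    where open ≡-Reasoning

  bottom : insertAt (suc k) black (removeAt (suc i) b) ≡ b′
  bottom = begin
    insertAt (suc k) black (removeAt (suc i) b)
      ≡⟨ cong (insertAt (suc k) black) (removeAt-++-∷ botFront black bS (cong suc (sym length-botFront))) ⟩
    insertAt (suc k) black (botFront ++ bS)
      ≡⟨ cong (insertAt (suc k) black) (++-∷ʳ-++ bP bM x bS) ⟩
    insertAt (suc k) black (bP ++ bM ++ x ∷ bS)
      ≡⟨ insertAt-++ bP black _ (cong suc lP) ⟩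
    b′ ∎
    where open ≡-Reasoning

  hits : T n (t , b) i ≡ (t′ , b′)
  hits rewrite T-a′ n t b (s≤s z≤n) i<n tᵢ tᵢ₊₁ bᵢ₊₁ | j₁ = cong₂ _,_ top bottom

  labelled : label n (t′ , b′) (t , b) i ≡ k
  labelled = trans (label-a′ n t′ b′ t b (eqConfig-false t b t′ b′ i tᵢ t′ᵢ) (s≤s z≤n) i<n bᵢ₊₁)
    (whiteRunStart-≡ tP (suc m) (black ∷ tS) ends (≤-trans (m≤m+n k m) (n≤1+n _)) (≤-reflexive (sym (+-suc k m))))

  path : Path 0 t′ b′ 0 → Path 0 t b 0
  path p′ = Path-under topFront botFront (trans length-topFront (sym length-botFront)) (insertNeutral white)
    (subst₂ (λ X Y → Path 0 X Y 0) (sym (++-∷ʳ-++ tP (replicate m white) black tS)) (sym (++-∷ʳ-++ bP bM x bS))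
      (Path-under tP bP lP (deleteNeutral white) p′))

  labelledPreimage : Path 0 t′ b′ 0 → Preimage n (t′ , b′) k
  labelledPreimage p′ = preimage (t , b) i (<⇒≤ i<n) (path⇒complete n t b length-t length-b (path p′)) hits labelled

module MoveC (tP bP : List Particle) (m : ℕ) (bM : List Particle)
  (ends : EmptyOrEndsWith black tP) (lP : length tP ≡ length bP) (lM : length bM ≡ m)
  where

  k n : ℕ
  k = length tP

  t′ b′ t b : List Particle
  t′ = tP ++ replicate (suc m) white
  b′ = bP ++ black ∷ bM
  t  = tP ++ replicate m white ++ black ∷ []
  b  = bP ++ bM ++ white ∷ []

  n = length t′

  length-t′ : n ≡ suc (k + m)
  length-t′ = trans (length-++ tP) (trans (cong (k +_) (length-replicate (suc m))) (+-suc k m))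

  length-t : length t ≡ n
  length-t = trans (length-++-∷ʳ tP (replicate m white) black)
                   (trans (cong (λ z → suc (k + z)) (length-replicate m)) (sym length-t′))

  length-b : length b ≡ n
  length-b = trans (length-++-∷ʳ bP bM white) (trans (cong suc (cong₂ _+_ (sym lP) lM)) (sym length-t′))

  t′-padded : t′ ≡ tP ++ replicate (suc m) white ++ []
  t′-padded = cong (tP ++_) (sym (++-identityʳ _))

  n-position : n ≡ suc (k + length (replicate m white))
  n-position = trans length-t′ (cong (λ z → suc (k + z)) (sym (length-replicate m)))

  tₙ : cell t n ≡ black
  tₙ = cell-++-++-∷ tP (replicate m white) black [] n-position

  t′ₙ : cell t′ n ≡ white
  t′ₙ = trans (cong (λ L → cell L n) t′-padded)
    (cell-replicate tP (suc m) white [] (subst (k <_) (sym length-t′) (s≤s (m≤m+n k m)))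
                    (≤-reflexive (trans length-t′ (sym (+-suc k m)))))

  j₁ : whiteRunStart t (n ∸ 1) ≡ k
  j₁ = trans (cong (λ z → whiteRunStart t (z ∸ 1)) length-t′) (whiteRunStart-≡ tP m (black ∷ []) ends (m≤m+n k m) ≤-refl)

  top : insertAt (suc k) white (removeAt n t) ≡ t′
  top = begin
    insertAt (suc k) white (removeAt n t)
      ≡⟨ cong (insertAt (suc k) white) (removeAt-++-++-∷ tP (replicate m white) black [] n-position) ⟩
    insertAt (suc k) white (tP ++ replicate m white ++ [])
      ≡⟨ insertAt-++ tP white _ refl ⟩
    tP ++ white ∷ replicate m white ++ []
      ≡⟨ cong (λ L → tP ++ white ∷ L) (++-identityʳ _) ⟩
    t′ ∎
    where open ≡-Reasoning

  bottom : insertAt (suc k) black (removeAt n b) ≡ b′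
  bottom = begin
    insertAt (suc k) black (removeAt n b)
      ≡⟨ cong (insertAt (suc k) black)
              (removeAt-++-++-∷ bP bM white [] (trans n-position (cong suc (cong₂ _+_ lP (trans (length-replicate m) (sym lM)))))) ⟩
    insertAt (suc k) black (bP ++ bM ++ [])
      ≡⟨ insertAt-++ bP black _ (cong suc lP) ⟩
    bP ++ black ∷ bM ++ []
      ≡⟨ cong (λ L → bP ++ black ∷ L) (++-identityʳ bM) ⟩
    b′ ∎
    where open ≡-Reasoning

  hits : T n (t , b) n ≡ (t′ , b′)
  hits rewrite T-c n t b (subst (0 <_) (sym length-t′) (s≤s z≤n)) tₙ | j₁ = cong₂ _,_ top bottom

  labelled : label n (t′ , b′) (t , b) n ≡ k
  labelled = trans (label-c n t′ b′ t b (eqConfig-false t b t′ b′ n tₙ t′ₙ))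
    (trans (cong (λ L → whiteRunStart L n) t′-padded)
      (whiteRunStart-≡ tP (suc m) [] ends (subst (k ≤_) (sym length-t′) (≤-trans (m≤m+n k m) (n≤1+n _)))
                       (≤-reflexive (trans length-t′ (sym (+-suc k m))))))

  path : Path 0 t′ b′ 0 → Path 0 t b 0
  path p′ = subst₂ (λ X Y → Path 0 X Y 0) (++-assoc tP (replicate m white) (black ∷ [])) (++-assoc bP bM (white ∷ []))
    (appendNeutral (tP ++ replicate m white) (bP ++ bM) black front-length (Path-under tP bP lP (deleteNeutral white) p′))
    where
    front-length : length (tP ++ replicate m white) ≡ length (bP ++ bM)
    front-length = trans (length-++ tP) (trans (cong₂ _+_ lP (trans (length-replicate m) (sym lM))) (sym (length-++ bP)))

  labelledPreimage : Path 0 t′ b′ 0 → Preimage n (t′ , b′) k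
  labelledPreimage p′ = preimage (t , b) n ≤-refl (path⇒complete n t b length-t length-b (path p′)) hits labelled

module MoveA″ (U V : List Particle) (s : ℕ) (N : List Particle) (y z : Particle) (tS bS : List Particle)
  (lU : length U ≡ length V) (lN : length N ≡ s) (lS : length tS ≡ length bS)
  where

  u q i k n : ℕ
  u = length U
  q = length tS
  i = suc u
  k = suc u + suc s

  t′ b′ t b : List Particle
  t′ = U ++ white ∷ replicate (suc s) black ++ white ∷ tS
  b′ = V ++ y ∷ N ++ z ∷ white ∷ bS
  t  = U ++ black ∷ white ∷ replicate s black ++ white ∷ tS
  b  = V ++ y ∷ white ∷ N ++ z ∷ bS

  n = length t′

  length-t′ : n ≡ u + suc (suc (s + suc q))
  length-t′ = trans (length-++ U)
    (cong (λ z → u + suc z) (trans (length-++ (replicate (suc s) black)) (cong (_+ suc q) (length-replicate (suc s)))))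

  length-t : length t ≡ n
  length-t = trans (length-++ U)
    (trans (cong (λ z → u + suc (suc z)) (trans (length-++ (replicate s black)) (cong (_+ suc q) (length-replicate s))))
           (sym length-t′))

  length-b : length b ≡ n
  length-b = trans (length-++ V)
    (trans (cong₂ (λ a c → a + suc (suc c)) (sym lU) (trans (length-++ N) (cong₂ (λ a c → a + suc c) lN (sym lS))))
           (sym length-t′))

  i<n : i < n
  i<n = subst (i <_) (sym (trans length-t′ (+-suc u _))) (s≤s (m<m+n u (s≤s z≤n)))

  k<n : k < n
  k<n = subst (k <_) (sym length-t′)
    (≤-trans (≤-reflexive (arith u s)) (+-monoʳ-≤ u (s≤s (s≤s (+-monoʳ-≤ s (s≤s z≤n))))))
    where
    arith : ∀ u s → suc (suc u + suc s) ≡ u + suc (suc (s + 1))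
    arith = solve-∀

  tᵢ : cell t i ≡ black
  tᵢ = cell-++-∷ U black _ refl

  tᵢ₊₁ : cell t (suc i) ≡ white
  tᵢ₊₁ = cell-++-++-∷ U (black ∷ []) white _ (cong suc (sym (+-comm u 1)))

  bᵢ₊₁ : cell b (suc i) ≡ white
  bᵢ₊₁ = cell-++-++-∷ V (y ∷ []) white _ (cong suc (trans (cong suc lU) (sym (+-comm (length V) 1))))

  t′ᵢ : cell t′ i ≡ white
  t′ᵢ = cell-++-∷ U white _ refl

  j₂ : blackRunEnd n t (suc i) ≡ k
  j₂ = begin
    blackRunEnd n t (suc i)
      ≡⟨ cong₂ (blackRunEnd n) t-split (sym length-W) ⟩
    blackRunEnd n (W ++ replicate s black ++ white ∷ tS) (length W)
      ≡⟨ blackRunEnd-≡ W s (white ∷ tS) (cons tS) (trans (sym length-t) (cong length t-split)) ⟩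
    length W + s
      ≡⟨ cong (_+ s) length-W ⟩
    suc (suc u) + s
      ≡⟨ cong suc (sym (+-suc u s)) ⟩
    k ∎
    where
    open ≡-Reasoning
    W = U ++ black ∷ white ∷ []
    length-W : length W ≡ suc i
    length-W = trans (length-++ U) (+-comm u 2)
    t-split : t ≡ W ++ replicate s black ++ white ∷ tS
    t-split = sym (++-assoc U (black ∷ white ∷ []) _)

  top : insertAt k black (removeAt i t) ≡ t′
  top = begin
    insertAt k black (removeAt i t)
      ≡⟨ cong (insertAt k black) (removeAt-++-∷ U black _ refl) ⟩
    insertAt k black (U ++ (white ∷ replicate s black) ++ white ∷ tS)
      ≡⟨ insertAt-++-++ U (white ∷ replicate s black) black (white ∷ tS)
                        (cong (λ z → suc (u + suc z)) (sym (length-replicate s))) ⟩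
    U ++ white ∷ replicate s black ++ black ∷ white ∷ tS
      ≡⟨ cong (λ L → U ++ white ∷ L) (sym (replicate-suc-++ s black (white ∷ tS))) ⟩
    t′ ∎
    where open ≡-Reasoning

  bottom : insertAt (suc k) white (removeAt (suc i) b) ≡ b′
  bottom = begin
    insertAt (suc k) white (removeAt (suc i) b)
      ≡⟨ cong (insertAt (suc k) white)
              (removeAt-++-++-∷ V (y ∷ []) white _ (cong suc (trans (cong suc lU) (sym (+-comm (length V) 1))))) ⟩
    insertAt (suc k) white (V ++ y ∷ N ++ z ∷ bS)
      ≡⟨ cong (insertAt (suc k) white) (sym (++-∷ʳ-++ V (y ∷ N) z bS)) ⟩
    insertAt (suc k) white ((V ++ y ∷ N ∷ʳ z) ++ bS)
      ≡⟨ insertAt-++ (V ++ y ∷ N ∷ʳ z) white bS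
           (cong suc (trans (cong suc (cong₂ (λ a c → a + suc c) lU (sym lN))) (sym (length-++-∷ʳ V (y ∷ N) z)))) ⟩
    (V ++ y ∷ N ∷ʳ z) ++ white ∷ bS
      ≡⟨ ++-∷ʳ-++ V (y ∷ N) z (white ∷ bS) ⟩
    b′ ∎
    where open ≡-Reasoning

  hits : T n (t , b) i ≡ (t′ , b′)
  hits rewrite T-a″ n t b (s≤s z≤n) i<n tᵢ tᵢ₊₁ bᵢ₊₁ | j₂ | <ᵇ-true⁺ k<n = cong₂ _,_ top bottom

  labelled : label n (t′ , b′) (t , b) i ≡ k
  labelled = begin
    label n (t′ , b′) (t , b) i
      ≡⟨ label-a″ n t′ b′ t b (eqConfig-false t b t′ b′ i tᵢ t′ᵢ) (s≤s z≤n) i<n bᵢ₊₁ ⟩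
    blackRunEnd n t′ i
      ≡⟨ cong₂ (blackRunEnd n) t′-split (sym length-W) ⟩
    blackRunEnd n (W ++ replicate (suc s) black ++ white ∷ tS) (length W)
      ≡⟨ blackRunEnd-≡ W (suc s) (white ∷ tS) (cons tS) (cong length t′-split) ⟩
    length W + suc s
      ≡⟨ cong (_+ suc s) length-W ⟩
    k ∎
    where
    open ≡-Reasoning
    W = U ∷ʳ white
    length-W : length W ≡ i
    length-W = trans (length-++ U) (+-comm u 1)
    t′-split : t′ ≡ W ++ replicate (suc s) black ++ white ∷ tS
    t′-split = sym (++-assoc U (white ∷ []) _)

  path : Path 0 t′ b′ 0 → Path 0 t b 0
  path = Path-under U V lU λ {m} p → splitColumn
    (Path-under (white ∷ replicate s black) (y ∷ N) (cong suc (trans (length-replicate s) (sym lN))) (mergeColumns z)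
      (subst (λ L → Path m (white ∷ L) (y ∷ N ++ z ∷ white ∷ bS) 0) (replicate-suc-++ s black (white ∷ tS)) p))

  labelledPreimage : Path 0 t′ b′ 0 → Preimage n (t′ , b′) k
  labelledPreimage p′ = preimage (t , b) i (<⇒≤ i<n) (path⇒complete n t b length-t length-b (path p′)) hits labelled

module MoveA″-end (U V : List Particle) (s : ℕ) (N : List Particle) (y : Particle)
  (lU : length U ≡ length V) (lN : length N ≡ s)
  where

  u i k n : ℕ
  u = length U
  i = suc u
  k = suc u + suc s

  t′ b′ t b : List Particle
  t′ = U ++ white ∷ replicate (suc s) black
  b′ = V ++ y ∷ N ∷ʳ white
  t  = U ++ black ∷ white ∷ replicate s black
  b  = V ++ y ∷ white ∷ N

  n = length t′

  length-t′ : n ≡ k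
  length-t′ = trans (length-++ U) (trans (cong (λ z → u + suc z) (length-replicate (suc s))) (+-suc u (suc s)))

  length-t : length t ≡ n
  length-t = trans (length-++ U) (trans (cong (λ z → u + suc (suc z)) (length-replicate s)) (trans (+-suc u (suc s)) (sym length-t′)))

  length-b : length b ≡ n
  length-b = trans (length-++ V) (trans (cong₂ (λ a c → a + suc (suc c)) (sym lU) lN) (trans (+-suc u (suc s)) (sym length-t′)))

  i<n : i < n
  i<n = subst (i <_) (sym length-t′) (s≤s (m<m+n u (s≤s z≤n)))

  tᵢ : cell t i ≡ black
  tᵢ = cell-++-∷ U black _ refl

  tᵢ₊₁ : cell t (suc i) ≡ white
  tᵢ₊₁ = cell-++-++-∷ U (black ∷ []) white _ (cong suc (sym (+-comm u 1)))

  bᵢ₊₁ : cell b (suc i) ≡ white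
  bᵢ₊₁ = cell-++-++-∷ V (y ∷ []) white _ (cong suc (trans (cong suc lU) (sym (+-comm (length V) 1))))

  t′ᵢ : cell t′ i ≡ white
  t′ᵢ = cell-++-∷ U white _ refl

  j₂ : blackRunEnd n t (suc i) ≡ n
  j₂ = begin
    blackRunEnd n t (suc i)
      ≡⟨ cong₂ (blackRunEnd n) t-split (sym length-W) ⟩
    blackRunEnd n (W ++ replicate s black) (length W)
      ≡⟨ blackRunEnd-≡-end W s (trans (sym length-t) (cong length t-split)) ⟩
    length W + s
      ≡⟨ cong (_+ s) length-W ⟩
    suc (suc u) + s
      ≡⟨ cong suc (sym (+-suc u s)) ⟩
    k
      ≡⟨ sym length-t′ ⟩
    n ∎
    where
    open ≡-Reasoning
    W = U ++ black ∷ white ∷ []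
    length-W : length W ≡ suc i
    length-W = trans (length-++ U) (+-comm u 2)
    t-split : t ≡ W ++ replicate s black
    t-split = sym (++-assoc U (black ∷ white ∷ []) _)

  top : insertAt n black (removeAt i t) ≡ t′
  top = begin
    insertAt n black (removeAt i t)
      ≡⟨ cong (insertAt n black) (removeAt-++-∷ U black _ refl) ⟩
    insertAt n black (U ++ white ∷ replicate s black)
      ≡⟨ insertAt-∷ʳ _ black
           (trans length-t′ (cong suc (sym (trans (length-++ U) (cong (λ z → u + suc z) (length-replicate s)))))) ⟩
    (U ++ white ∷ replicate s black) ∷ʳ black
      ≡⟨ ++-assoc U (white ∷ replicate s black) (black ∷ []) ⟩
    U ++ white ∷ replicate s black ∷ʳ black
      ≡⟨ cong (λ L → U ++ white ∷ L) (replicate-∷ʳ s black) ⟩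
    t′ ∎
    where open ≡-Reasoning

  bottom : insertAt n white (removeAt (suc i) b) ≡ b′
  bottom = begin
    insertAt n white (removeAt (suc i) b)
      ≡⟨ cong (insertAt n white)
              (removeAt-++-++-∷ V (y ∷ []) white N (cong suc (trans (cong suc lU) (sym (+-comm (length V) 1))))) ⟩
    insertAt n white (V ++ y ∷ N)
      ≡⟨ insertAt-∷ʳ (V ++ y ∷ N) white
           (trans length-t′ (cong suc (sym (trans (length-++ V) (cong₂ (λ a c → a + suc c) (sym lU) lN))))) ⟩
    (V ++ y ∷ N) ∷ʳ white
      ≡⟨ ++-assoc V (y ∷ N) (white ∷ []) ⟩
    b′ ∎
    where open ≡-Reasoning

  hits : T n (t , b) i ≡ (t′ , b′)
  hits rewrite T-a″ n t b (s≤s z≤n) i<n tᵢ tᵢ₊₁ bᵢ₊₁ | j₂ | <ᵇ-irrefl n = cong₂ _,_ top bottom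

  labelled : label n (t′ , b′) (t , b) i ≡ k
  labelled = begin
    label n (t′ , b′) (t , b) i
      ≡⟨ label-a″ n t′ b′ t b (eqConfig-false t b t′ b′ i tᵢ t′ᵢ) (s≤s z≤n) i<n bᵢ₊₁ ⟩
    blackRunEnd n t′ i
      ≡⟨ cong₂ (blackRunEnd n) t′-split (sym length-W) ⟩
    blackRunEnd n (W ++ replicate (suc s) black) (length W)
      ≡⟨ blackRunEnd-≡-end W (suc s) (cong length t′-split) ⟩
    length W + suc s
      ≡⟨ cong (_+ suc s) length-W ⟩
    k ∎
    where
    open ≡-Reasoning
    W = U ∷ʳ white
    length-W : length W ≡ i
    length-W = trans (length-++ U) (+-comm u 1)
    t′-split : t′ ≡ W ++ replicate (suc s) black
    t′-split = sym (++-assoc U (white ∷ []) _)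

  path : Path 0 t′ b′ 0 → Path 0 t b 0
  path = Path-under U V lU λ {m} p → splitColumn
    (dropLastNeutral (white ∷ replicate s black) (y ∷ N) black (cong suc (trans (length-replicate s) (sym lN)))
      (subst (λ L → Path m (white ∷ L) (y ∷ N ∷ʳ white) 0) (sym (replicate-∷ʳ s black)) p))

  labelledPreimage : Path 0 t′ b′ 0 → Preimage n (t′ , b′) k
  labelledPreimage p′ = preimage (t , b) i (<⇒≤ i<n) (path⇒complete n t b length-t length-b (path p′)) hits labelled

module MoveB (s : ℕ) (N : List Particle) (z : Particle) (tS bS : List Particle)
  (lN : length N ≡ s) (lS : length tS ≡ length bS)
  where

  q k n : ℕ
  q = length tS
  k = suc s

  t′ b′ t b : List Particle
  t′ = replicate (suc s) black ++ white ∷ tS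
  b′ = N ++ z ∷ white ∷ bS
  t  = white ∷ replicate s black ++ white ∷ tS
  b  = black ∷ N ++ z ∷ bS

  n = length t′

  length-t′ : n ≡ suc (s + suc q)
  length-t′ = trans (length-++ (replicate (suc s) black)) (cong (_+ suc q) (length-replicate (suc s)))

  length-t : length t ≡ n
  length-t = trans (cong suc (trans (length-++ (replicate s black)) (cong (_+ suc q) (length-replicate s)))) (sym length-t′)

  length-b : length b ≡ n
  length-b = trans (cong suc (trans (length-++ N) (cong₂ (λ a c → a + suc c) lN (sym lS)))) (sym length-t′)

  k<n : k < n
  k<n = subst (k <_) (sym length-t′) (s≤s (m<m+n s (s≤s z≤n)))

  j₂ : blackRunEnd n t 1 ≡ k
  j₂ = blackRunEnd-≡ (white ∷ []) s (white ∷ tS) (cons tS) (sym length-t)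

  top : insertAt k black (removeAt 1 t) ≡ t′
  top = trans (insertAt-++ (replicate s black) black (white ∷ tS) (cong suc (sym (length-replicate s))))
              (sym (replicate-suc-++ s black (white ∷ tS)))

  bottom : insertAt (suc k) white (removeAt 1 b) ≡ b′
  bottom = begin
    insertAt (suc k) white (N ++ z ∷ bS)
      ≡⟨ cong (insertAt (suc k) white) (sym (++-∷ʳ-++ [] N z bS)) ⟩
    insertAt (suc k) white ((N ∷ʳ z) ++ bS)
      ≡⟨ insertAt-++ (N ∷ʳ z) white bS (cong suc (trans (cong suc (sym lN)) (sym (length-++-∷ʳ [] N z)))) ⟩
    (N ∷ʳ z) ++ white ∷ bS
      ≡⟨ ++-∷ʳ-++ [] N z (white ∷ bS) ⟩
    b′ ∎
    where open ≡-Reasoning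

  hits : T n (t , b) 0 ≡ (t′ , b′)
  hits rewrite T-b n t b refl | j₂ | <ᵇ-true⁺ k<n = cong₂ _,_ top bottom

  labelled : label n (t′ , b′) (t , b) 0 ≡ k
  labelled = trans (label-b n t′ b′ t b (eqConfig-false t b t′ b′ 1 refl refl) (subst (0 <_) (sym length-t′) (s≤s z≤n)))
                   (blackRunEnd-≡ [] (suc s) (white ∷ tS) (cons tS) refl)

  path : Path 0 t′ b′ 0 → Path 0 t b 0
  path p′ = wb (Path-under (replicate s black) N (trans (length-replicate s) (sym lN)) (mergeColumns z)
    (subst (λ L → Path 0 L b′ 0) (replicate-suc-++ s black (white ∷ tS)) p′))

  labelledPreimage : Path 0 t′ b′ 0 → Preimage n (t′ , b′) k
  labelledPreimage p′ = preimage (t , b) 0 z≤n (path⇒complete n t b length-t length-b (path p′)) hits labelled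

module MoveB-end (s : ℕ) (N : List Particle) (lN : length N ≡ s) where

  k n : ℕ
  k = suc s

  t′ b′ t b : List Particle
  t′ = replicate (suc s) black
  b′ = N ∷ʳ white
  t  = white ∷ replicate s black
  b  = black ∷ N

  n = length t′

  length-t′ : n ≡ k
  length-t′ = length-replicate (suc s)

  length-t : length t ≡ n
  length-t = trans (cong suc (length-replicate s)) (sym length-t′)

  length-b : length b ≡ n
  length-b = trans (cong suc lN) (sym length-t′)

  j₂ : blackRunEnd n t 1 ≡ n
  j₂ = trans (blackRunEnd-≡-end (white ∷ []) s (sym length-t)) (sym length-t′)

  top : insertAt n black (removeAt 1 t) ≡ t′
  top = trans (insertAt-∷ʳ (replicate s black) black (trans length-t′ (cong suc (sym (length-replicate s))))) (replicate-∷ʳ s black)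

  bottom : insertAt n white (removeAt 1 b) ≡ b′
  bottom = insertAt-∷ʳ N white (trans length-t′ (cong suc (sym lN)))

  hits : T n (t , b) 0 ≡ (t′ , b′)
  hits rewrite T-b n t b refl | j₂ | <ᵇ-irrefl n = cong₂ _,_ top bottom

  labelled : label n (t′ , b′) (t , b) 0 ≡ k
  labelled = trans (label-b n t′ b′ t b (eqConfig-false t b t′ b′ 1 refl refl) (subst (0 <_) (sym length-t′) (s≤s z≤n)))
                   (blackRunEnd-≡-end [] (suc s) refl)

  path : Path 0 t′ b′ 0 → Path 0 t b 0
  path p′ = wb (dropLastNeutral (replicate s black) N black (trans (length-replicate s) (sym lN))
    (subst (λ L → Path 0 L b′ 0) (sym (replicate-∷ʳ s black)) p′))

  labelledPreimage : Path 0 t′ b′ 0 → Preimage n (t′ , b′) k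
  labelledPreimage p′ = preimage (t , b) 0 z≤n (path⇒complete n t b length-t length-b (path p′)) hits labelled

preimage-whiteBlack : ∀ n tP bP tR bR → EmptyOrEndsWith black tP → length tP ≡ length bP → length tR ≡ length bR →
  length (tP ++ white ∷ tR) ≡ n → Path 0 (tP ++ white ∷ tR) (bP ++ black ∷ bR) 0 →
  Preimage n (tP ++ white ∷ tR , bP ++ black ∷ bR) (length tP)
preimage-whiteBlack n tP bP tR bR ends lP lR ln p with leadingRun white tR
... | whole m = Preimage-transport (MoveC.labelledPreimage tP bP m bR ends lP (trans (sym lR) (length-replicate m))) refl refl ln refl p
... | stop m tS with splitLike (replicate m white) (black ∷ tS) bR lR
...   | split bM (x ∷ bS) lM lS =
  Preimage-transport (MoveA′.labelledPreimage tP bP m bM x tS bS ends lP (trans (sym lM) (length-replicate m)) (suc-injective lS))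
    refl refl ln refl p
...   | split bM [] lM ()

preimage-whiteWhite : ∀ n t₀ tR b₀ z bR → length t₀ ≡ length b₀ → length tR ≡ length bR →
  length ((t₀ ∷ʳ black) ++ white ∷ tR) ≡ n → Path 0 ((t₀ ∷ʳ black) ++ white ∷ tR) ((b₀ ∷ʳ z) ++ white ∷ bR) 0 →
  Preimage n ((t₀ ∷ʳ black) ++ white ∷ tR , (b₀ ∷ʳ z) ++ white ∷ bR) (length (t₀ ∷ʳ black))
preimage-whiteWhite n t₀ tR b₀ z bR l₀ lR ln p with trailingRun black t₀
... | whole s =
  Preimage-transport (MoveB.labelledPreimage s b₀ z tR bR (trans (sym l₀) (length-replicate s)) lR)
    (cong (_++ white ∷ tR) (replicate-∷ʳ s black)) (∷ʳ-++ b₀ z (white ∷ bR)) ln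
    (sym (trans (length-∷ʳ (replicate s black) black) (cong suc (length-replicate s)))) p
... | stop U s with splitLike U (white ∷ replicate s black) b₀ l₀
...   | split V [] lU ()
...   | split V (y ∷ N) lU lN =
  Preimage-transport (MoveA″.labelledPreimage U V s N y z tR bR lU (trans (sym (suc-injective lN)) (length-replicate s)) lR)
    top-eq bottom-eq ln k-eq p
  where
  top-eq : ((U ++ white ∷ replicate s black) ∷ʳ black) ++ white ∷ tR ≡ U ++ white ∷ replicate (suc s) black ++ white ∷ tR
  top-eq = trans (∷ʳ-++ (U ++ white ∷ replicate s black) black (white ∷ tR))
    (trans (++-assoc U (white ∷ replicate s black) (black ∷ white ∷ tR))
      (cong (λ L → U ++ white ∷ L) (sym (replicate-suc-++ s black (white ∷ tR)))))
  bottom-eq : ((V ++ y ∷ N) ∷ʳ z) ++ white ∷ bR ≡ V ++ y ∷ N ++ z ∷ white ∷ bR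
  bottom-eq = trans (∷ʳ-++ (V ++ y ∷ N) z (white ∷ bR)) (++-assoc V (y ∷ N) (z ∷ white ∷ bR))
  k-eq : suc (length U) + suc s ≡ length ((U ++ white ∷ replicate s black) ∷ʳ black)
  k-eq = sym (trans (length-∷ʳ (U ++ white ∷ replicate s black) black)
                    (cong suc (trans (length-++ U) (cong (λ z → length U + suc z) (length-replicate s)))))

preimage-lastBlack : ∀ n t₀ b₀ → length t₀ ≡ length b₀ → length (t₀ ∷ʳ black) ≡ n →
  Path 0 (t₀ ∷ʳ black) (b₀ ∷ʳ white) 0 → Preimage n (t₀ ∷ʳ black , b₀ ∷ʳ white) n
preimage-lastBlack n t₀ b₀ l₀ ln p with trailingRun black t₀
... | whole s =
  Preimage-transport (MoveB-end.labelledPreimage s b₀ (trans (sym l₀) (length-replicate s))) (replicate-∷ʳ s black) refl ln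
    (trans (sym (trans (length-∷ʳ (replicate s black) black) (cong suc (length-replicate s)))) ln) p
... | stop U s with splitLike U (white ∷ replicate s black) b₀ l₀
...   | split V [] lU ()
...   | split V (y ∷ N) lU lN =
  Preimage-transport (MoveA″-end.labelledPreimage U V s N y lU (trans (sym (suc-injective lN)) (length-replicate s)))
    top-eq (++-assoc V (y ∷ N) (white ∷ [])) ln k-eq p
  where
  top-eq : (U ++ white ∷ replicate s black) ∷ʳ black ≡ U ++ white ∷ replicate (suc s) black
  top-eq = trans (++-assoc U (white ∷ replicate s black) (black ∷ [])) (cong (λ L → U ++ white ∷ L) (replicate-∷ʳ s black))
  k-eq : suc (length U) + suc s ≡ n
  k-eq = trans (sym (trans (length-∷ʳ (U ++ white ∷ replicate s black) black)
                           (cong suc (trans (length-++ U) (cong (λ z → length U + suc z) (length-replicate s)))))) ln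

preimage-wall-n : ∀ n t′ b′ → 0 < n → isComplete n (t′ , b′) ≡ true → Preimage n (t′ , b′) n
preimage-wall-n n t′ b′ 0<n complete with complete⇒path n t′ b′ complete
... | lt , lb , p with initLast t′ | initLast b′
... | []           | _            = ⊥-elim (<⇒≢ 0<n lt)
... | _ ∷ʳ′ _      | []           = ⊥-elim (<⇒≢ 0<n lb)
... | t₀ ∷ʳ′ false | b₀ ∷ʳ′ v     =
  loop n _ n ≤-refl complete (T-loop-n n _ _ 0<n (cell-++-∷ t₀ white [] (trans (sym lt) (length-∷ʳ t₀ white))))
... | t₀ ∷ʳ′ true  | b₀ ∷ʳ′ true  = ⊥-elim (¬Path-ending-bb t₀ b₀ (∷ʳ-length-injective t₀ b₀ (trans lt (sym lb))) p)
... | t₀ ∷ʳ′ true  | b₀ ∷ʳ′ false = preimage-lastBlack n t₀ b₀ (∷ʳ-length-injective t₀ b₀ (trans lt (sym lb))) lt p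

loop-inner : ∀ n t₀ a u tR b → length ((t₀ ∷ʳ a) ++ u ∷ tR) ≡ n → isComplete n ((t₀ ∷ʳ a) ++ u ∷ tR , b) ≡ true →
  (a ∧ not u) ≡ false → Preimage n ((t₀ ∷ʳ a) ++ u ∷ tR , b) (length (t₀ ∷ʳ a))
loop-inner n t₀ a u tR b ln complete stays =
  loop n _ i (<⇒≤ i<n) complete (T-loop n t b 0<i i<n (trans (cong₂ (λ x y → x ∧ not y) tᵢ tᵢ₊₁) stays))
  where
  t = (t₀ ∷ʳ a) ++ u ∷ tR
  i = length (t₀ ∷ʳ a)
  0<i : 0 < i
  0<i = subst (0 <_) (sym (length-∷ʳ t₀ a)) (s≤s z≤n)
  i<n : i < n
  i<n = subst (i <_) (trans (sym (length-++ (t₀ ∷ʳ a))) ln) (m<m+n i (s≤s z≤n))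
  tᵢ : cell t i ≡ a
  tᵢ = trans (cong (λ L → cell L i) (∷ʳ-++ t₀ a (u ∷ tR))) (cell-++-∷ t₀ a (u ∷ tR) (length-∷ʳ t₀ a))
  tᵢ₊₁ : cell t (suc i) ≡ u
  tᵢ₊₁ = cell-++-∷ (t₀ ∷ʳ a) u tR refl

preimage-innerWall : ∀ n t₀ a u tR b₀ z v bR → length t₀ ≡ length b₀ → length tR ≡ length bR →
  length ((t₀ ∷ʳ a) ++ u ∷ tR) ≡ n → isComplete n ((t₀ ∷ʳ a) ++ u ∷ tR , (b₀ ∷ʳ z) ++ v ∷ bR) ≡ true →
  Path 0 ((t₀ ∷ʳ a) ++ u ∷ tR) ((b₀ ∷ʳ z) ++ v ∷ bR) 0 →
  Preimage n ((t₀ ∷ʳ a) ++ u ∷ tR , (b₀ ∷ʳ z) ++ v ∷ bR) (length (t₀ ∷ʳ a))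
preimage-innerWall n t₀ false u     tR b₀ z v     bR l₀ lR ln complete p = loop-inner n t₀ false u tR _ ln complete refl
preimage-innerWall n t₀ true  true  tR b₀ z v     bR l₀ lR ln complete p = loop-inner n t₀ true true tR _ ln complete refl
preimage-innerWall n t₀ true  false tR b₀ z true  bR l₀ lR ln complete p =
  preimage-whiteBlack n (t₀ ∷ʳ black) (b₀ ∷ʳ z) tR bR (snoc t₀)
    (trans (length-∷ʳ t₀ black) (trans (cong suc l₀) (sym (length-∷ʳ b₀ z)))) lR ln p
preimage-innerWall n t₀ true  false tR b₀ z false bR l₀ lR ln complete p = preimage-whiteWhite n t₀ tR b₀ z bR l₀ lR ln p

preimage-leftWall : ∀ n u tR v bR → length tR ≡ length bR → length (u ∷ tR) ≡ n →
  isComplete n (u ∷ tR , v ∷ bR) ≡ true → Path 0 (u ∷ tR) (v ∷ bR) 0 → Preimage n (u ∷ tR , v ∷ bR) 0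
preimage-leftWall n true  tR v     bR lR ln complete p  = loop n _ 0 z≤n complete (T-loop-0 n _ _ refl)
preimage-leftWall n false tR true  bR lR ln complete p  = preimage-whiteBlack n [] [] tR bR empty refl lR ln p
preimage-leftWall n false tR false bR lR ln complete ()

preimage-atColumn : ∀ n tP u tR bP v bR → length tP ≡ length bP → length tR ≡ length bR →
  length (tP ++ u ∷ tR) ≡ n → isComplete n (tP ++ u ∷ tR , bP ++ v ∷ bR) ≡ true →
  Path 0 (tP ++ u ∷ tR) (bP ++ v ∷ bR) 0 → Preimage n (tP ++ u ∷ tR , bP ++ v ∷ bR) (length tP)
preimage-atColumn n tP u tR bP v bR lP lR ln complete p with initLast tP | initLast bP
... | []       | []       = preimage-leftWall n u tR v bR lR ln complete p
... | t₀ ∷ʳ′ a | b₀ ∷ʳ′ z = preimage-innerWall n t₀ a u tR b₀ z v bR (∷ʳ-length-injective t₀ b₀ lP) lR ln complete p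
... | []       | b₀ ∷ʳ′ z = ⊥-elim (0≢1+n (trans lP (length-∷ʳ b₀ z)))
... | t₀ ∷ʳ′ a | []       = ⊥-elim (0≢1+n (trans (sym lP) (length-∷ʳ t₀ a)))

preimage-wall<n : ∀ n t′ b′ k → k < n → isComplete n (t′ , b′) ≡ true → Preimage n (t′ , b′) k
preimage-wall<n n t′ b′ k k<n complete with complete⇒path n t′ b′ complete
... | lt , lb , p with columnSplit k t′ b′ (subst (k <_) (sym lt) k<n) (trans lt (sym lb))
... | split tP u tR bP v bR refl lP lR = preimage-atColumn n tP u tR bP v bR lP lR lt complete p

preimage-exists : ∀ n → 0 < n → ∀ ω′ → isComplete n ω′ ≡ true → ∀ k → k ≤ n → Preimage n ω′ k
preimage-exists n 0<n (t′ , b′) complete k k≤n with m≤n⇒m<n∨m≡n k≤n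
... | inj₁ k<n  = preimage-wall<n n t′ b′ k k<n complete
... | inj₂ refl = preimage-wall-n n t′ b′ 0<n complete

-- Counting moves

𝟙 : Bool → ℕ
𝟙 true  = 1
𝟙 false = 0

sumℕ : {A : Set} → (A → ℕ) → List A → ℕ
sumℕ f = foldr (λ x r → f x + r) 0

module _ {A : Set} where

  sumℕ-cong : ∀ (f g : A → ℕ) xs → (∀ x → f x ≡ g x) → sumℕ f xs ≡ sumℕ g xs
  sumℕ-cong f g []       f≗g = refl
  sumℕ-cong f g (x ∷ xs) f≗g = cong₂ _+_ (f≗g x) (sumℕ-cong f g xs f≗g)

  sumℕ-mono : ∀ (f g : A → ℕ) xs → (∀ x → f x ≤ g x) → sumℕ f xs ≤ sumℕ g xs
  sumℕ-mono f g []       f≤g = z≤n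
  sumℕ-mono f g (x ∷ xs) f≤g = +-mono-≤ (f≤g x) (sumℕ-mono f g xs f≤g)

  sumℕ-zero : ∀ (xs : List A) → sumℕ (λ _ → 0) xs ≡ 0
  sumℕ-zero []       = refl
  sumℕ-zero (_ ∷ xs) = sumℕ-zero xs

  sumℕ-+ : ∀ (f g : A → ℕ) xs → sumℕ (λ x → f x + g x) xs ≡ sumℕ f xs + sumℕ g xs
  sumℕ-+ f g []       = refl
  sumℕ-+ f g (x ∷ xs) rewrite sumℕ-+ f g xs = interchange (f x) (g x) (sumℕ f xs) (sumℕ g xs)

  sumℕ-++ : ∀ (f : A → ℕ) xs ys → sumℕ f (xs ++ ys) ≡ sumℕ f xs + sumℕ f ys
  sumℕ-++ f []       ys = refl
  sumℕ-++ f (x ∷ xs) ys = trans (cong (f x +_) (sumℕ-++ f xs ys)) (sym (+-assoc (f x) (sumℕ f xs) (sumℕ f ys)))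

  sumℕ-∈ : ∀ (f : A → ℕ) {x xs} → x ∈ xs → f x ≤ sumℕ f xs
  sumℕ-∈ f {xs = y ∷ xs} (here refl) = m≤m+n (f y) (sumℕ f xs)
  sumℕ-∈ f {xs = y ∷ xs} (there x∈)  = ≤-trans (sumℕ-∈ f x∈) (m≤n+m (sumℕ f xs) (f y))

  sumℕ-≥ : ∀ (f : A → ℕ) c xs → (∀ {x} → x ∈ xs → c ≤ f x) → length xs * c ≤ sumℕ f xs
  sumℕ-≥ f c []       c≤f = z≤n
  sumℕ-≥ f c (x ∷ xs) c≤f = +-mono-≤ (c≤f (here refl)) (sumℕ-≥ f c xs (c≤f ∘ there))

  sumℕ-≤ : ∀ (f : A → ℕ) c xs → (∀ x → f x ≤ c) → sumℕ f xs ≤ length xs * c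
  sumℕ-≤ f c []       f≤c = z≤n
  sumℕ-≤ f c (x ∷ xs) f≤c = +-mono-≤ (f≤c x) (sumℕ-≤ f c xs f≤c)

  sumℕ-filterB : ∀ (f : A → ℕ) p xs → sumℕ f (filterB p xs) ≤ sumℕ f xs
  sumℕ-filterB f p []       = z≤n
  sumℕ-filterB f p (x ∷ xs) with p x
  ... | true  = +-monoʳ-≤ (f x) (sumℕ-filterB f p xs)
  ... | false = ≤-trans (sumℕ-filterB f p xs) (m≤n+m (sumℕ f xs) (f x))

  sumℕ-tight : ∀ (f : A → ℕ) c xs → (∀ {x} → x ∈ xs → c ≤ f x) → sumℕ f xs ≤ length xs * c →
    ∀ {x} → x ∈ xs → f x ≡ c
  sumℕ-tight f c xs c≤f sum≤ {x} x∈ =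
    ≤-antisym (m∸n≡0⇒m≤n (n≤0⇒n≡0 (+-cancelʳ-≤ (length xs * c) (f x ∸ c) 0 (≤-trans (excess xs x∈ c≤f) sum≤))))
              (c≤f x∈)
    where
    excess : ∀ ys → x ∈ ys → (∀ {y} → y ∈ ys → c ≤ f y) → (f x ∸ c) + length ys * c ≤ sumℕ f ys
    excess (y ∷ ys) (here refl) c≤f = begin
      (f x ∸ c) + (c + length ys * c)   ≡⟨ sym (+-assoc (f x ∸ c) c _) ⟩
      (f x ∸ c) + c + length ys * c     ≡⟨ cong (_+ length ys * c) (m∸n+n≡m (c≤f (here refl))) ⟩
      f x + length ys * c               ≤⟨ +-monoʳ-≤ (f x) (sumℕ-≥ f c ys (c≤f ∘ there)) ⟩
      f x + sumℕ f ys                   ∎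
      where open ≤-Reasoning
    excess (y ∷ ys) (there x∈) c≤f = begin
      (f x ∸ c) + (c + length ys * c)   ≡⟨ solve-swap (f x ∸ c) c (length ys * c) ⟩
      c + ((f x ∸ c) + length ys * c)   ≤⟨ +-mono-≤ (c≤f (here refl)) (excess ys x∈ (c≤f ∘ there)) ⟩
      f y + sumℕ f ys                   ∎
      where
      open ≤-Reasoning
      solve-swap : ∀ a b d → a + (b + d) ≡ b + (a + d)
      solve-swap = solve-∀

sumℕ-map : ∀ {A B : Set} (f : B → ℕ) (g : A → B) xs → sumℕ f (map g xs) ≡ sumℕ (f ∘ g) xs
sumℕ-map f g []       = refl
sumℕ-map f g (x ∷ xs) = cong (f (g x) +_) (sumℕ-map f g xs)

sumℕ-concatMap : ∀ {A B : Set} (f : B → ℕ) (g : A → List B) xs → sumℕ f (concatMap g xs) ≡ sumℕ (sumℕ f ∘ g) xs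
sumℕ-concatMap f g []       = refl
sumℕ-concatMap f g (x ∷ xs) = trans (sumℕ-++ f (g x) (concatMap g xs)) (cong (sumℕ f (g x) +_) (sumℕ-concatMap f g xs))

sumℕ-swap : ∀ {A B : Set} (f : A → B → ℕ) xs ys →
  sumℕ (λ x → sumℕ (f x) ys) xs ≡ sumℕ (λ y → sumℕ (λ x → f x y) xs) ys
sumℕ-swap f []       ys = sym (sumℕ-zero ys)
sumℕ-swap f (x ∷ xs) ys =
  trans (cong (sumℕ (f x) ys +_) (sumℕ-swap f xs ys)) (sym (sumℕ-+ (f x) (λ y → sumℕ (λ x → f x y) xs) ys))

sumℕ-cartesianProduct : ∀ {A B : Set} (f : A × B → ℕ) xs ys →
  sumℕ f (cartesianProduct xs ys) ≡ sumℕ (λ x → sumℕ (λ y → f (x , y)) ys) xs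
sumℕ-cartesianProduct f []       ys = refl
sumℕ-cartesianProduct f (x ∷ xs) ys =
  trans (sumℕ-++ f (map (x ,_) ys) (cartesianProduct xs ys))
        (cong₂ _+_ (sumℕ-map f (x ,_) ys) (sumℕ-cartesianProduct f xs ys))

length-cartesianProduct : ∀ {A B : Set} (xs : List A) (ys : List B) → length (cartesianProduct xs ys) ≡ length xs * length ys
length-cartesianProduct []       ys = refl
length-cartesianProduct (x ∷ xs) ys =
  trans (length-++ (map (x ,_) ys)) (cong₂ _+_ (length-map (x ,_) ys) (length-cartesianProduct xs ys))

length≤count-labelled : ∀ {X : Set} (P : X → Bool) (ℓ : X → ℕ) xs ks →
  (∀ a → sumℕ (𝟙 ∘ (a ≡ᵇ_)) ks ≤ 1) → (∀ {k} → k ∈ ks → Σ X λ x → x ∈ xs × P x ≡ true × ℓ x ≡ k) →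
  length ks ≤ sumℕ (𝟙 ∘ P) xs
length≤count-labelled {X} P ℓ xs ks distinct witness = begin
  length ks                                                ≡⟨ sym (*-identityʳ _) ⟩
  length ks * 1                                            ≤⟨ sumℕ-≥ (λ k → sumℕ (labelledBy k) xs) 1 ks hit ⟩
  sumℕ (λ k → sumℕ (labelledBy k) xs) ks                   ≡⟨ sumℕ-swap (λ k x → labelledBy k x) ks xs ⟩
  sumℕ (λ x → sumℕ (λ k → labelledBy k x) ks) xs           ≤⟨ sumℕ-mono _ (𝟙 ∘ P) xs atMostOne ⟩
  sumℕ (𝟙 ∘ P) xs                                          ∎
  where
  open ≤-Reasoning
  labelledBy : ℕ → X → ℕ
  labelledBy k x = 𝟙 (P x ∧ (ℓ x ≡ᵇ k))
  hit : ∀ {k} → k ∈ ks → 1 ≤ sumℕ (labelledBy k) xs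
  hit {k} k∈ with witness k∈
  ... | x , x∈ , Px , ℓx = subst (_≤ sumℕ (labelledBy k) xs) one (sumℕ-∈ (labelledBy k) x∈)
    where
    one : labelledBy k x ≡ 1
    one rewrite Px | ℓx | ≡ᵇ-true⁺ {k} refl = refl
  atMostOne : ∀ x → sumℕ (λ k → labelledBy k x) ks ≤ 𝟙 (P x)
  atMostOne x with P x
  ... | true  = distinct (ℓ x)
  ... | false = ≤-reflexive (sumℕ-zero ks)

interval-below : ∀ a lo l → a < lo → sumℕ (𝟙 ∘ (a ≡ᵇ_)) (interval lo l) ≡ 0
interval-below a lo zero    _    = refl
interval-below a lo (suc l) a<lo rewrite ≡ᵇ-false⁺ (<⇒≢ a<lo) = interval-below a (suc lo) l (m<n⇒m<1+n a<lo)

interval-distinct : ∀ a lo l → sumℕ (𝟙 ∘ (a ≡ᵇ_)) (interval lo l) ≤ 1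
interval-distinct a lo zero    = z≤n
interval-distinct a lo (suc l) with a ≡ᵇ lo in eq
... | true  = s≤s (≤-reflexive (interval-below a (suc lo) l (≤-reflexive (cong suc (≡ᵇ-true⁻ eq)))))
... | false = interval-distinct a (suc lo) l

range-distinct : ∀ n a → sumℕ (𝟙 ∘ (a ≡ᵇ_)) (range 0 n) ≤ 1
range-distinct n a = subst (λ ks → sumℕ (𝟙 ∘ (a ≡ᵇ_)) ks ≤ 1) (sym (range≡interval 0 n)) (interval-distinct a 0 (suc n))

∈-filterB⁺ : ∀ {A : Set} p {x : A} {xs} → p x ≡ true → x ∈ xs → x ∈ filterB p xs
∈-filterB⁺ p {xs = y ∷ xs} px (here refl) rewrite px = here refl
∈-filterB⁺ p {xs = y ∷ xs} px (there x∈) with p y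
... | true  = there (∈-filterB⁺ p px x∈)
... | false = ∈-filterB⁺ p px x∈

∈-filterB⁻ : ∀ {A : Set} p {x : A} xs → x ∈ filterB p xs → p x ≡ true
∈-filterB⁻ p (y ∷ xs) x∈ with p y in py
∈-filterB⁻ p (y ∷ xs) (here refl) | true  = py
∈-filterB⁻ p (y ∷ xs) (there x∈)  | true  = ∈-filterB⁻ p xs x∈
∈-filterB⁻ p (y ∷ xs) x∈          | false = ∈-filterB⁻ p xs x∈

∈-rows : ∀ n (r : List Particle) → length r ≡ n → r ∈ rows n
∈-rows zero    []          _   = here refl
∈-rows (suc n) (true ∷ r)  len = ∈-concat⁺′ (here refl) (∈-map⁺ _ (∈-rows n r (suc-injective len)))
∈-rows (suc n) (false ∷ r) len = ∈-concat⁺′ (there (here refl)) (∈-map⁺ _ (∈-rows n r (suc-injective len)))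

rows-distinct : ∀ n x → sumℕ (𝟙 ∘ eqRow x) (rows n) ≤ 1
rows-distinct zero    []          = s≤s z≤n
rows-distinct zero    (true ∷ x)  = z≤n
rows-distinct zero    (false ∷ x) = z≤n
rows-distinct (suc n) x = subst (_≤ 1) (sym (sumℕ-concatMap (𝟙 ∘ eqRow x) _ (rows n))) (extended x)
  where
  extended : ∀ x → sumℕ (λ r → 𝟙 (eqRow x (true ∷ r)) + (𝟙 (eqRow x (false ∷ r)) + 0)) (rows n) ≤ 1
  extended []          = ≤-trans (≤-reflexive (sumℕ-zero (rows n))) z≤n
  extended (true ∷ x)  = subst (_≤ 1) (sumℕ-cong _ _ (rows n) (λ r → sym (+-identityʳ _))) (rows-distinct n x)
  extended (false ∷ x) = subst (_≤ 1) (sumℕ-cong _ _ (rows n) (λ r → sym (+-identityʳ _))) (rows-distinct n x)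

∈-Ω⁰ : ∀ n ω → isComplete n ω ≡ true → ω ∈ Ω⁰ n
∈-Ω⁰ n (t , b) complete with complete⇒path n t b complete
... | lt , lb , _ = ∈-filterB⁺ (isComplete n) complete
  (∈-concat⁺′ (∈-map⁺ (t ,_) (∈-rows n b lb)) (∈-map⁺ (λ t → map (t ,_) (rows n)) (∈-rows n t lt)))

Ω⁰-complete : ∀ n {ω} → ω ∈ Ω⁰ n → isComplete n ω ≡ true
Ω⁰-complete n = ∈-filterB⁻ (isComplete n) (concatMap (λ t → map (t ,_) (rows n)) (rows n))

Ω⁰-distinct : ∀ n ω → sumℕ (𝟙 ∘ eqConfig ω) (Ω⁰ n) ≤ 1
Ω⁰-distinct n ω@(x , y) = begin
  sumℕ (𝟙 ∘ eqConfig ω) (Ω⁰ n)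
    ≤⟨ sumℕ-filterB (𝟙 ∘ eqConfig ω) (isComplete n) (concatMap pairs (rows n)) ⟩
  sumℕ (𝟙 ∘ eqConfig ω) (concatMap pairs (rows n))
    ≡⟨ sumℕ-concatMap (𝟙 ∘ eqConfig ω) pairs (rows n) ⟩
  sumℕ (λ t → sumℕ (𝟙 ∘ eqConfig ω) (pairs t)) (rows n)
    ≤⟨ sumℕ-mono _ (𝟙 ∘ eqRow x) (rows n) sameTop ⟩
  sumℕ (𝟙 ∘ eqRow x) (rows n)
    ≤⟨ rows-distinct n x ⟩
  1 ∎
  where
  open ≤-Reasoning
  pairs : List Particle → List Config
  pairs t = map (t ,_) (rows n)
  sameTop : ∀ t → sumℕ (𝟙 ∘ eqConfig ω) (pairs t) ≤ 𝟙 (eqRow x t)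
  sameTop t rewrite sumℕ-map (𝟙 ∘ eqConfig ω) (t ,_) (rows n) with eqRow x t
  ... | true  = rows-distinct n y
  ... | false = ≤-reflexive (sumℕ-zero (rows n))

moves : ℕ → List (Config × ℕ)
moves n = cartesianProduct (Ω⁰ n) (range 0 n)

indegree : ℕ → Config → ℕ
indegree n ω′ = sumℕ (λ (ω , i) → 𝟙 (eqConfig (T n ω i) ω′)) (moves n)

indegree-≥ : ∀ n → 0 < n → ∀ {ω′} → ω′ ∈ Ω⁰ n → suc n ≤ indegree n ω′
indegree-≥ n 0<n {ω′} ω′∈ = subst (_≤ indegree n ω′) (length-range n)
  (length≤count-labelled (λ (ω , i) → eqConfig (T n ω i) ω′) (λ (ω , i) → label n ω′ ω i) (moves n) (range 0 n)
    (range-distinct n) witness)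
  where
  witness : ∀ {k} → k ∈ range 0 n → Σ (Config × ℕ) λ (ω , i) →
    (ω , i) ∈ moves n × eqConfig (T n ω i) ω′ ≡ true × label n ω′ ω i ≡ k
  witness {k} k∈ with preimage-exists n 0<n ω′ (Ω⁰-complete n ω′∈) k (∈-range⁻ n k∈)
  ... | preimage ω i i≤n complete hits labelled =
    (ω , i) , ∈-cartesianProduct⁺ (∈-Ω⁰ n ω complete) (∈-range⁺ i≤n) ,
    trans (cong (λ ω″ → eqConfig ω″ ω′) hits) (eqConfig-refl ω′) , labelled

indegree-total : ∀ n → sumℕ (indegree n) (Ω⁰ n) ≤ length (Ω⁰ n) * suc n
indegree-total n = begin
  sumℕ (indegree n) (Ω⁰ n)
    ≡⟨ sumℕ-swap hit (Ω⁰ n) (moves n) ⟩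
  sumℕ (λ m → sumℕ (λ ω′ → hit ω′ m) (Ω⁰ n)) (moves n)
    ≤⟨ sumℕ-≤ _ 1 (moves n) (λ (ω , i) → Ω⁰-distinct n (T n ω i)) ⟩
  length (moves n) * 1
    ≡⟨ *-identityʳ _ ⟩
  length (moves n)
    ≡⟨ length-cartesianProduct (Ω⁰ n) (range 0 n) ⟩
  length (Ω⁰ n) * length (range 0 n)
    ≡⟨ cong (length (Ω⁰ n) *_) (length-range n) ⟩
  length (Ω⁰ n) * suc n ∎
  where
  open ≤-Reasoning
  hit : Config → Config × ℕ → ℕ
  hit ω′ (ω , i) = 𝟙 (eqConfig (T n ω i) ω′)

indegree-≡ : ∀ n → 0 < n → ∀ {ω′} → ω′ ∈ Ω⁰ n → indegree n ω′ ≡ suc n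
indegree-≡ n 0<n = sumℕ-tight (indegree n) (suc n) (Ω⁰ n) (indegree-≥ n 0<n) (indegree-total n)

-- Stationarity

fromℕ : ℕ → ℚ
fromℕ m = mkℚ (ℤ.+ m) 0 (coprime-sym (1-coprimeTo m))

fromℕ-+ : ∀ a b → fromℕ a +ℚ fromℕ b ≡ fromℕ (a + b)
fromℕ-+ a b = trans (cong (_/ 1) numerator) (ℚ.normalize-coprime (coprime-sym (1-coprimeTo (a + b))))
  where
  numerator : ℤ.+ a ℤ.* ℤ.+ 1 ℤ.+ ℤ.+ b ℤ.* ℤ.+ 1 ≡ ℤ.+ (a + b)
  numerator = trans (cong₂ ℤ._+_ (ℤ.*-identityʳ (ℤ.+ a)) (ℤ.*-identityʳ (ℤ.+ b))) (sym (ℤ.pos-+ a b))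

ind≡fromℕ∘𝟙 : ∀ b → ind b ≡ fromℕ (𝟙 b)
ind≡fromℕ∘𝟙 true  = refl
ind≡fromℕ∘𝟙 false = refl

module _ {A : Set} where

  sumℚ-cong : ∀ (f g : A → ℚ) xs → (∀ x → f x ≡ g x) → sumℚ f xs ≡ sumℚ g xs
  sumℚ-cong f g []       f≗g = refl
  sumℚ-cong f g (x ∷ xs) f≗g = cong₂ _+ℚ_ (f≗g x) (sumℚ-cong f g xs f≗g)

  sumℚ-*ˡ : ∀ c (f : A → ℚ) xs → sumℚ (λ x → c *ℚ f x) xs ≡ c *ℚ sumℚ f xs
  sumℚ-*ˡ c f []       = sym (ℚ.*-zeroʳ c)
  sumℚ-*ˡ c f (x ∷ xs) = trans (cong (c *ℚ f x +ℚ_) (sumℚ-*ˡ c f xs)) (sym (ℚ.*-distribˡ-+ c (f x) (sumℚ f xs)))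

  sumℚ-fromℕ : ∀ (h : A → ℕ) xs → sumℚ (fromℕ ∘ h) xs ≡ fromℕ (sumℕ h xs)
  sumℚ-fromℕ h []       = refl
  sumℚ-fromℕ h (x ∷ xs) = trans (cong (fromℕ (h x) +ℚ_) (sumℚ-fromℕ h xs)) (fromℕ-+ (h x) (sumℕ h xs))

1/[1+n]*[1+n] : ∀ n → (ℤ.+ 1 / suc n) *ℚ fromℕ (suc n) ≡ 1ℚ
1/[1+n]*[1+n] n = trans (cong (_*ℚ fromℕ (suc n)) (ℚ.normalize-coprime (1-coprimeTo (suc n)))) (ℚ.*-inverseˡ (fromℕ (suc n)))

rate-111 : ∀ n i → rate n 1ℚ 1ℚ 1ℚ i ≡ 1ℚ
rate-111 n i with i ≡ᵇ 0 | i ≡ᵇ n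
... | true  | _     = refl
... | false | true  = refl
... | false | false = refl

hitsFrom : ℕ → Config → Config → ℕ
hitsFrom n ω′ ω = sumℕ (λ i → 𝟙 (eqConfig (T n ω i) ω′)) (range 0 n)

P-111 : ∀ n ω ω′ → P n 1ℚ 1ℚ 1ℚ ω ω′ ≡ (ℤ.+ 1 / suc n) *ℚ fromℕ (hitsFrom n ω′ ω)
P-111 n ω ω′ =
  trans (sumℚ-cong _ (λ i → q *ℚ fromℕ (𝟙 (eqConfig (T n ω i) ω′))) (range 0 n) term)
    (trans (sumℚ-*ˡ q (λ i → fromℕ (𝟙 (eqConfig (T n ω i) ω′))) (range 0 n))
           (cong (q *ℚ_) (sumℚ-fromℕ (λ i → 𝟙 (eqConfig (T n ω i) ω′)) (range 0 n))))
  where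
  q = ℤ.+ 1 / suc n
  term : ∀ i → q *ℚ (rate n 1ℚ 1ℚ 1ℚ i *ℚ ind (eqConfig (T n ω i) ω′)
                      +ℚ (1ℚ -ℚ rate n 1ℚ 1ℚ 1ℚ i) *ℚ ind (eqConfig ω ω′))
             ≡ q *ℚ fromℕ (𝟙 (eqConfig (T n ω i) ω′))
  term i rewrite rate-111 n i | ℚ.+-inverseʳ 1ℚ | ℚ.*-zeroˡ (ind (eqConfig ω ω′))
               | ℚ.+-identityʳ (1ℚ *ℚ ind (eqConfig (T n ω i) ω′)) | ℚ.*-identityˡ (ind (eqConfig (T n ω i) ω′))
               | ind≡fromℕ∘𝟙 (eqConfig (T n ω i) ω′) = refl

weighted-inflow : ∀ n c ω′ →
  sumℚ (λ ω → c *ℚ P n 1ℚ 1ℚ 1ℚ ω ω′) (Ω⁰ n) ≡ c *ℚ ((ℤ.+ 1 / suc n) *ℚ fromℕ (indegree n ω′))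
weighted-inflow n c ω′ = begin
  sumℚ (λ ω → c *ℚ P n 1ℚ 1ℚ 1ℚ ω ω′) (Ω⁰ n)
    ≡⟨ sumℚ-cong _ _ (Ω⁰ n) (λ ω → cong (c *ℚ_) (P-111 n ω ω′)) ⟩
  sumℚ (λ ω → c *ℚ (q *ℚ fromℕ (hitsFrom n ω′ ω))) (Ω⁰ n)
    ≡⟨ sumℚ-*ˡ c _ (Ω⁰ n) ⟩
  c *ℚ sumℚ (λ ω → q *ℚ fromℕ (hitsFrom n ω′ ω)) (Ω⁰ n)
    ≡⟨ cong (c *ℚ_) (sumℚ-*ˡ q _ (Ω⁰ n)) ⟩
  c *ℚ (q *ℚ sumℚ (fromℕ ∘ hitsFrom n ω′) (Ω⁰ n))
    ≡⟨ cong (λ x → c *ℚ (q *ℚ x)) (sumℚ-fromℕ (hitsFrom n ω′) (Ω⁰ n)) ⟩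
  c *ℚ (q *ℚ fromℕ (sumℕ (hitsFrom n ω′) (Ω⁰ n)))
    ≡⟨ cong (λ x → c *ℚ (q *ℚ fromℕ x)) (sym (sumℕ-cartesianProduct _ (Ω⁰ n) (range 0 n))) ⟩
  c *ℚ (q *ℚ fromℕ (indegree n ω′)) ∎
  where
  open ≡-Reasoning
  q = ℤ.+ 1 / suc n

theorem2 : (n : ℕ) → n ≥ 1 → IsStationary n 1ℚ 1ℚ 1ℚ (uniform n)
theorem2 n n≥1 ω′ ω′∈Ω = begin
  sumℚ (λ ω → u *ℚ P n 1ℚ 1ℚ 1ℚ ω ω′) (Ω⁰ n)   ≡⟨ weighted-inflow n u ω′ ⟩
  u *ℚ (q *ℚ fromℕ (indegree n ω′))            ≡⟨ cong (λ d → u *ℚ (q *ℚ fromℕ d)) (indegree-≡ n n≥1 ω′∈Ω) ⟩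
  u *ℚ (q *ℚ fromℕ (suc n))                    ≡⟨ cong (u *ℚ_) (1/[1+n]*[1+n] n) ⟩
  u *ℚ 1ℚ                                      ≡⟨ ℚ.*-identityʳ u ⟩
  u                                            ∎
  where
  open ≡-Reasoning
  u = uniformWeight (length (Ω⁰ n))
  q = ℤ.+ 1 / suc n
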